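{- Let $(T,\mathcal{C},\mathcal{I},A)$ be a storyline instance and let $S$ be a storyline solution for it. Then one can construct from $S$ a type-2-consistent storyline solution $S'$ with $\operatorname{cr}(S')\le \operatorname{cr}(S)$. Moreover, if $S$ is type-1-consistent, then $S'$ is also type-1-consistent.
   Context: A storyline instance $(T,\mathcal{C},\mathcal{I},A)$ consists of totally ordered time steps $T=\{t_1,\dots,t_\ell\}$, a set of characters $\mathcal{C}$, a set of interactions $\mathcal{I}$, where each interaction $I$ has a time step $\operatorname{time}(I)\in T$ and a character set $\operatorname{char}(I)\subseteq\mathcal{C}$, and a map $A$ assigning to each character $c$ a set of consecutive time steps $A(c)=\{t_i,\dots,t_j\}$ (the steps at which $c$ is active). Let $\operatorname{AC}(t)=\{c: t\in A(c)\}$, $\operatorname{AC}(t_i,t_j)=\operatorname{AC}(t_i)\cap\dots\cap\operatorname{AC}(t_j)$, $\mathcal{I}(t)=\{I:\operatorname{time}(I)=t\}$ and $\operatorname{CI}(t)=\bigcup_{I\in\mathcal{I}(t)}\operatorname{char}(I)$. It is assumed that $\operatorname{char}(I)\subseteq\operatorname{AC}(\operatorname{time}(I))$ for all $I$, that $\mathcal{I}(t)\neq\emptyset$ for every $t$, and that the character sets of the interactions at a common time step are pairwise disjoint. A storyline solution is a sequence $S=(\pi_1,\dots,\pi_\ell)$ where $\pi_i$ is a permutation (linear order) of $\operatorname{AC}(t_i)$ in which, for every $I\in\mathcal{I}(t_i)$, the characters of $\operatorname{char}(I)$ appear consecutively. For a permutation $\pi$ of $X$ and $Y\subseteq X$,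 $\pi[Y]$ denotes the restriction of $\pi$ to $Y$; $\pi\star\phi$ denotes concatenation of permutations of disjoint sets. For consecutive steps, $\operatorname{cr}(\pi_i,\pi_{i+1})$ is the number of pairs $\{c,c'\}\subseteq C=\operatorname{AC}(t_i)\cap\operatorname{AC}(t_{i+1})$ whose relative order differs in $\pi_i[C]$ and $\pi_{i+1}[C]$, and $\operatorname{cr}(S)=\sum_{i=1}^{\ell-1}\operatorname{cr}(\pi_i,\pi_{i+1})$. Type-1 consistency: for an interaction $I$ with $\operatorname{time}(I)=t_i$ and $C=\operatorname{char}(I)$, let $j(I)\in\{1,\dots,i\}$ be the smallest index such that $C\subseteq\operatorname{AC}(t_{j(I)},t_i)$ and for every $k\in\{j(I)+1,\dots,i\}$ either $\operatorname{CI}(t_k)\cap C=\emptyset$ or there is $I'\in\mathcal{I}(t_k)$ with $C\subseteq\operatorname{char}(I')$. $S$ is $I$-consistent if $\pi_k[C]=\pi_i[C]$ for all $k\in\{j(I),\dots,i\}$; $S$ is type-1-consistent if it is $I$-consistent for all $I\in\mathcal{I}$. Type-2 consistency: consider interactions $I_1,I_2$ with $\operatorname{char}(I_1)=\operatorname{char}(I_2)=C$, $\operatorname{time}(I_1)=t_i$, $\operatorname{time}(I_2)=t_j$, $i<j$, such that for every $k$ with $i<k<j$ either $\operatorname{CI}(t_k)\cap C=\emptyset$ or there is $I_3\in\mathcal{I}(t_k)$ with $C\subseteq\operatorname{char}(I_3)$. $S$ is $(I_1,I_2)$-consistent if for every $i<k<j$ there are permutations $\pi^a,\pi^b$ with $\pi_k=\pi^a\star\pi_i[C]\star\pi^b$.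 $S$ is type-2-consistent if it is $(I_1,I_2)$-consistent for all such pairs. -}

module Defs where

open import Data.Nat using (ℕ; zero; suc; _+_; _<ᵇ_)
open import Data.Bool using (Bool; true; false; T?)
open import Data.Fin as F using (Fin; inject₁)
open import Data.Fin.Subset as Sub using (Subset)
open import Data.Fin.Subset.Properties as SubP using ()
open import Data.List using (List; []; _∷_; _++_; filter; map; length)
open import Data.Nat.ListAction using (sum)
open import Data.List.Base using (allFin)
open import Data.List.Membership.Propositional using (_∈_)
open import Data.List.Relation.Unary.Unique.Propositional using (Unique)
open import Data.Product using (Σ; ∃; _×_; _,_)
open import Data.Sum using (_⊎_)
open import Data.Empty using (⊥)
open import Relation.Nullary using (Dec; yes; no; ¬_)
open import Relation.Nullary.Decidable using (_×-dec_)
open import Relation.Binary.PropositionalEquality using (_≡_; _≢_)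

-- Storyline instances (T, C, I, A)
-- time steps  t_1 < ... < t_ℓ  are  Fin ℓ  (0-based, ordered by F._≤_)
-- characters are Fin n, interactions are Fin m
-- A(c) = { t : lo c ≤ t ≤ hi c }  (a nonempty set of consecutive steps)

record Instance : Set where
  field
    ℓ n m  : ℕ
    lo hi  : Fin n → Fin ℓ
    lo≤hi  : ∀ c → lo c F.≤ hi c
    time   : Fin m → Fin ℓ
    char   : Fin m → Subset n

  Active : Fin n → Fin ℓ → Set
  Active c t = lo c F.≤ t × t F.≤ hi c

  active? : ∀ c t → Dec (Active c t)
  active? c t = (lo c F.≤? t) ×-dec (t F.≤? hi c)

  field
    char⊆AC   : ∀ I c → c Sub.∈ char I → Active c (time I)
    nonempty  : ∀ t → ∃ λ I → time I ≡ t
    disjoint  : ∀ I I' → I ≢ I' → time I ≡ time I' →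
                ∀ c → c Sub.∈ char I → c Sub.∈ char I' → ⊥

open Instance public

module _ (Ins : Instance) where
  open Instance Ins using () renaming (ℓ to L; n to N; m to M)

  IsPermOf : List (Fin N) → Fin L → Set
  IsPermOf π t = Unique π × (∀ c → (c ∈ π → Active Ins c t) × (Active Ins c t → c ∈ π))

  Consecutive : List (Fin N) → Subset N → Set
  Consecutive π C = ∃ λ πa → ∃ λ πb → ∃ λ πc →
    (π ≡ πa ++ πb ++ πc) × (∀ c → (c ∈ πb → c Sub.∈ C) × (c Sub.∈ C → c ∈ πb))

  record Solution : Set where
    field
      perm     : Fin L → List (Fin N)
      isPerm   : ∀ t → IsPermOf (perm t) t
      consec   : ∀ I → Consecutive (perm (time Ins I)) (char Ins I)

  open Solution public

restrict : ∀ {n} → List (Fin n) → Subset n → List (Fin n)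
restrict π Y = filter (λ c → c SubP.∈? Y) π

pos : ∀ {n} → Fin n → List (Fin n) → ℕ
pos x []       = 0
pos x (y ∷ ys) with x F.≟ y
... | yes _ = 0
... | no  _ = suc (pos x ys)

-- number of pairs (x , y) with x before y in p but y before x in q;
-- for p, q orderings of the same set this is the number of unordered
-- pairs whose relative order differs
crossPairs : ∀ {n} → List (Fin n) → List (Fin n) → ℕ
crossPairs []       q = 0
crossPairs (x ∷ xs) q =
  length (filter (λ y → T? (pos y q <ᵇ pos x q)) xs) + crossPairs xs q

consecutiveSum : ∀ {ℓ} → (Fin ℓ → Fin ℓ → ℕ) → ℕ
consecutiveSum {zero}  f = 0
consecutiveSum {suc k} f = sum (map (λ i → f (inject₁ i) (F.suc i)) (allFin k))

module _ {Ins : Instance} where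
  open Instance Ins using () renaming (ℓ to L; n to N; m to M)

  restrictAC : List (Fin N) → Fin L → Fin L → List (Fin N)
  restrictAC π t t' = filter (λ c → active? Ins c t ×-dec active? Ins c t') π

  crStep : Solution Ins → Fin L → Fin L → ℕ
  crStep S t t' = crossPairs (restrictAC (perm S t) t t') (restrictAC (perm S t') t t')

  cr : Solution Ins → ℕ
  cr S = consecutiveSum (crStep S)

  Quiet : Fin L → Subset N → Set
  Quiet k C =
    (∀ I' → time Ins I' ≡ k → ∀ c → c Sub.∈ char Ins I' → c Sub.∈ C → ⊥)
    ⊎ (∃ λ I' → time Ins I' ≡ k × C Sub.⊆ char Ins I')

  ValidStart : Fin M → Fin L → Set
  ValidStart I j =
    j F.≤ time Ins I
    × (∀ k → j F.≤ k → k F.≤ time Ins I → ∀ c → c Sub.∈ char Ins I → Active Ins c k)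
    × (∀ k → j F.< k → k F.≤ time Ins I → Quiet k (char Ins I))

  IsStart : Fin M → Fin L → Set
  IsStart I j = ValidStart I j × (∀ j' → ValidStart I j' → j F.≤ j')

  I-consistent : Solution Ins → Fin M → Set
  I-consistent S I = ∀ j → IsStart I j →
    ∀ k → j F.≤ k → k F.≤ time Ins I →
    restrict (perm S k) (char Ins I) ≡ restrict (perm S (time Ins I)) (char Ins I)

  Type1Consistent : Solution Ins → Set
  Type1Consistent S = ∀ I → I-consistent S I

  Type2Pair : Fin M → Fin M → Set
  Type2Pair I₁ I₂ =
    char Ins I₁ ≡ char Ins I₂
    × time Ins I₁ F.< time Ins I₂
    × (∀ k → time Ins I₁ F.< k → k F.< time Ins I₂ → Quiet k (char Ins I₁))

  Pair-consistent : Solution Ins → Fin M → Fin M → Set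
  Pair-consistent S I₁ I₂ =
    ∀ k → time Ins I₁ F.< k → k F.< time Ins I₂ →
    ∃ λ πa → ∃ λ πb →
      perm S k ≡ πa ++ restrict (perm S (time Ins I₁)) (char Ins I₁) ++ πb

  Type2Consistent : Solution Ins → Set
  Type2Consistent S = ∀ I₁ I₂ → Type2Pair I₁ I₂ → Pair-consistent S I₁ I₂

-- For a type-2 pair (I₁ , I₂) with character set C, let ω be the order of C at I₁.  At every
-- step strictly between the two interactions, delete the other members of C and put the block ω
-- at the position of one pivot c ∈ C.  Only crossings inside this window change: two members of
-- C now keep their order there, so they cross at most once, and only if they also crossed before;
-- pairs outside C are untouched; a member of C crosses an outsider exactly when c does.  Taking
-- the pivot of least mixed crossing cost therefore does not increase the crossing number.
-- Restrictions to interaction sets are either untouched, frozen to their value at I₁, or moved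
-- along with C, which preserves type-1 consistency.  Repairing the pairs in order of the time of
-- I₁ never breaks a pair repaired earlier, so one sweep makes every pair consistent.

{-# OPTIONS --safe #-}
module Submission where

open import Data.Nat as ℕ using (ℕ; zero; suc; _+_; _≤_; _<_; _<ᵇ_; z≤n; s≤s; z<s; s<s)
open import Data.Nat.Properties as ℕP
  using (+-identityʳ; +-mono-≤; +-monoʳ-≤; +-monoʳ-<; m≤m+n; <⇒≤; <ᵇ⇒<; 0≢1+n; suc-injective)
open import Algebra.Properties.CommutativeMonoid.Sum ℕP.+-0-commutativeMonoid
  using (sum-syntax; ∑-distrib-+; ∑-comm; sum-cong-≗; sum-replicate-zero)
open import Data.Bool using (Bool; true; false; not; _∧_; if_then_else_; T; T?)
open import Data.Bool.Properties as Bool using (∧-inverseʳ)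
open import Data.Empty using (⊥-elim)
open import Data.Fin as F using (Fin; toℕ)
open import Data.Fin.Properties as FP using ()
open import Data.Fin.Subset using (Subset) renaming (_∈_ to _∈ₛ_; _∉_ to _∉ₛ_; _⊆_ to _⊆ₛ_)
open import Data.Fin.Subset.Properties using () renaming (_∈?_ to _∈ₛ?_; _⊆?_ to _⊆ₛ?_)
open import Data.List using (List; []; _∷_; _++_; [_]; filter; length; map; concatMap; allFin; tabulate; cartesianProduct)
open import Data.List.Extrema ℕP.≤-totalOrder using (argmin; argmin-all; f[argmin]≤f[⊤]; f[argmin]≤f[xs])
open import Data.List.Membership.Propositional using (_∈_; _∉_)
open import Data.List.Membership.Propositional.Properties
  using (∈-++⁺ˡ; ∈-++⁺ʳ; ∈-++⁻; ∈-∃++; ∈-filter⁺; ∈-filter⁻; ∈-allFin; ∈-cartesianProduct⁺)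
import Data.List.Membership.DecPropositional as DecMembership
open import Data.List.Properties
  using (++-assoc; ++-identityʳ; map-tabulate; concatMap-++; filter-++; filter-all; filter-none; filter-accept; filter-reject)
open import Data.List.Relation.Binary.Disjoint.Propositional using (Disjoint)
open import Data.List.Relation.Unary.All as All using (All; []; _∷_)
import Data.List.Relation.Unary.All.Properties as All
open import Data.List.Relation.Unary.Any using (here; there)
open import Data.List.Relation.Unary.Unique.Propositional using (Unique; []; _∷_)
import Data.List.Relation.Unary.Unique.Propositional.Properties as Unique
import Data.Nat.ListAction as List
open import Data.Product using (Σ; ∃; ∃₂; _×_; _,_; proj₁; proj₂; swap)
open import Data.Sum using (_⊎_; inj₁; inj₂; [_,_]′)
open import Data.Vec.Properties using (≡-dec)
open import Function using (_∘_; case_of_)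
open import Relation.Binary.Definitions using (tri<; tri≈; tri>)
open import Relation.Binary.PropositionalEquality hiding ([_])
open import Relation.Nullary using (Dec; yes; no; ¬_; does)
open import Relation.Nullary.Decidable using (_×-dec_; _⊎-dec_; _→-dec_)
open import Relation.Unary using (Pred; Decidable; ∁)
open import Relation.Unary.Properties using (∁?)

open import Defs hiding (time; char; char⊆AC; disjoint; Active; active?)

⟦_⟧·_ : Bool → ℕ → ℕ
⟦ b ⟧· v = if b then v else 0

⟦_⟧ : Bool → ℕ
⟦ b ⟧ = ⟦ b ⟧· 1

⟦⟧·-split : ∀ b v → v ≡ ⟦ b ⟧· v + ⟦ not b ⟧· v
⟦⟧·-split true  v = sym (+-identityʳ v)
⟦⟧·-split false v = refl

⟦⟧·-distrib-+ : ∀ b u v → ⟦ b ⟧· (u + v) ≡ ⟦ b ⟧· u + ⟦ b ⟧· v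
⟦⟧·-distrib-+ true  u v = refl
⟦⟧·-distrib-+ false u v = refl

⟦⟧·-comm : ∀ a b v → ⟦ a ⟧· ⟦ b ⟧· v ≡ ⟦ b ⟧· ⟦ a ⟧· v
⟦⟧·-comm true  b     v = refl
⟦⟧·-comm false true  v = refl
⟦⟧·-comm false false v = refl

witness : ∀ {p} {P : Set p} (P? : Dec P) → T (does P?) → P
witness (yes p) _ = p

witness¬ : ∀ {p} {P : Set p} (P? : Dec P) → T (not (does P?)) → ¬ P
witness¬ (no ¬p) _ = ¬p

⟦⟧·-yes : ∀ {p} {P : Set p} (P? : Dec P) → P → ∀ v → ⟦ does P? ⟧· v ≡ v
⟦⟧·-yes (yes _) _  v = refl
⟦⟧·-yes (no ¬p) p v = ⊥-elim (¬p p)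

⟦⟧·-cong : ∀ b {u v} → (T b → u ≡ v) → ⟦ b ⟧· u ≡ ⟦ b ⟧· v
⟦⟧·-cong true  eq = eq _
⟦⟧·-cong false eq = refl

⟦⟧·-mono-≤ : ∀ b {u v} → (T b → u ≤ v) → ⟦ b ⟧· u ≤ ⟦ b ⟧· v
⟦⟧·-mono-≤ true  le = le _
⟦⟧·-mono-≤ false le = z≤n

⟦⟧·-∑ : ∀ {n} b (f : Fin n → ℕ) → ⟦ b ⟧· (∑[ x < n ] f x) ≡ ∑[ x < n ] ⟦ b ⟧· f x
⟦⟧·-∑     true  f = refl
⟦⟧·-∑ {n} false f = sym (sum-replicate-zero n)

∑∑ : ∀ {n} → (Fin n → Fin n → ℕ) → ℕ
∑∑ {n} H = ∑[ x < n ] ∑[ y < n ] H x y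

∑-mono-≤ : ∀ {n} {f g : Fin n → ℕ} → (∀ x → f x ≤ g x) → ∑[ x < n ] f x ≤ ∑[ x < n ] g x
∑-mono-≤ {zero}  le = z≤n
∑-mono-≤ {suc n} le = +-mono-≤ (le F.zero) (∑-mono-≤ (le ∘ F.suc))

∑-δ : ∀ {n} (z : Fin n) (f : Fin n → ℕ) → ∑[ x < n ] ⟦ does (x F.≟ z) ⟧· f x ≡ f z
∑-δ {suc n} F.zero    f = trans (cong (f F.zero +_) (sum-replicate-zero n)) (+-identityʳ _)
∑-δ {suc n} (F.suc z) f = ∑-δ z (f ∘ F.suc)

sum-map-allFin : ∀ k (g : Fin k → ℕ) → List.sum (map g (allFin k)) ≡ ∑[ s < k ] g s
sum-map-allFin k g = trans (cong List.sum (map-tabulate {n = k} (λ s → s) g)) (sum-tabulate k g)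
  where
  sum-tabulate : ∀ k (g : Fin k → ℕ) → List.sum (tabulate g) ≡ ∑[ s < k ] g s
  sum-tabulate zero    g = refl
  sum-tabulate (suc k) g = cong (g F.zero +_) (sum-tabulate k (g ∘ F.suc))

module _ {A : Set} where

  unique-++⁻ʳ : ∀ (u : List A) {v} → Unique (u ++ v) → Unique v
  unique-++⁻ʳ []      uv       = uv
  unique-++⁻ʳ (_ ∷ u) (_ ∷ uv) = unique-++⁻ʳ u uv

  unique-++⁻ˡ : ∀ (u : List A) {v} → Unique (u ++ v) → Unique u
  unique-++⁻ˡ []      _         = []
  unique-++⁻ˡ (_ ∷ u) (x∉ ∷ uv) = All.++⁻ˡ u x∉ ∷ unique-++⁻ˡ u uv

  unique-++⇒disjoint : ∀ (u : List A) {v} → Unique (u ++ v) → Disjoint u v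
  unique-++⇒disjoint (_ ∷ u) (x∉ ∷ _)  (here refl , xv) = All.lookup x∉ (∈-++⁺ʳ u xv) refl
  unique-++⇒disjoint (_ ∷ u) (_ ∷ uv) (there xu , xv)  = unique-++⇒disjoint u uv (xu , xv)

  unique-split : ∀ {c : A} {l} → Unique l → c ∈ l → ∃₂ λ a b → l ≡ a ++ c ∷ b × c ∉ a × c ∉ b
  unique-split {c} ul cl with ∈-∃++ cl
  ... | a , b , refl = a , b , refl , (λ ca → unique-++⇒disjoint a ul (ca , here refl))
                               , (λ cb → unique-∷⇒∉ (unique-++⁻ʳ a ul) cb)
    where
    unique-∷⇒∉ : ∀ {x : A} {xs} → Unique (x ∷ xs) → x ∉ xs
    unique-∷⇒∉ (x∉ ∷ _) m = All.lookup x∉ m refl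

  filter-++₃ : ∀ {p} {P : Pred A p} (P? : Decidable P) u v w →
               filter P? (u ++ v ++ w) ≡ filter P? u ++ filter P? v ++ filter P? w
  filter-++₃ P? u v w = trans (filter-++ P? u (v ++ w)) (cong (filter P? u ++_) (filter-++ P? v w))

  filter-comm : ∀ {p q} {P : Pred A p} {Q : Pred A q} (P? : Decidable P) (Q? : Decidable Q) →
                ∀ l → filter P? (filter Q? l) ≡ filter Q? (filter P? l)
  filter-comm P? Q? []      = refl
  filter-comm P? Q? (x ∷ l) with P? x | Q? x
  ... | yes px  | yes qx  = trans (filter-accept P? px)
                              (trans (cong (x ∷_) (filter-comm P? Q? l)) (sym (filter-accept Q? qx)))
  ... | yes _   | no ¬qx  = trans (filter-comm P? Q? l) (sym (filter-reject Q? ¬qx))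
  ... | no ¬px  | yes _   = trans (filter-reject P? ¬px) (filter-comm P? Q? l)
  ... | no _    | no _    = filter-comm P? Q? l

  filter-filter : ∀ {p q} {P : Pred A p} {Q : Pred A q} (P? : Decidable P) (Q? : Decidable Q) →
                  (∀ {x} → P x → Q x) → ∀ l → filter P? (filter Q? l) ≡ filter P? l
  filter-filter P? Q? P⇒Q []      = refl
  filter-filter P? Q? P⇒Q (x ∷ l) with Q? x | P? x
  ... | yes _  | yes px = trans (filter-accept P? px) (cong (x ∷_) (filter-filter P? Q? P⇒Q l))
  ... | yes _  | no ¬px = trans (filter-reject P? ¬px) (filter-filter P? Q? P⇒Q l)
  ... | no ¬qx | yes px = ⊥-elim (¬qx (P⇒Q px))
  ... | no _   | no _   = filter-filter P? Q? P⇒Q l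

  ++-reassociate : ∀ (p q r s t : List A) → p ++ (q ++ r ++ s) ++ t ≡ (p ++ q) ++ r ++ s ++ t
  ++-reassociate p q r s t = trans (cong (p ++_) (trans (++-assoc q (r ++ s) t) (cong (q ++_) (++-assoc r s t))))
                                   (sym (++-assoc p q (r ++ s ++ t)))

  unique-block⇒avoids : ∀ {p} {P : Pred A p} u v w → Unique (u ++ v ++ w) → (∀ {x} → P x → x ∈ v) →
                        All (∁ P) u × All (∁ P) w
  unique-block⇒avoids u v w uvw P⊆v =
    All.tabulate (λ xu px → unique-++⇒disjoint u uvw (xu , ∈-++⁺ˡ (P⊆v px))) ,
    All.tabulate (λ xw px → unique-++⇒disjoint v (unique-++⁻ʳ u uvw) (P⊆v px , xw))

  filter-block : ∀ {p} {P : Pred A p} (P? : Decidable P) u v w → Unique (u ++ v ++ w) →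
                 All P v → (∀ {x} → P x → x ∈ v) → filter P? (u ++ v ++ w) ≡ v
  filter-block P? u v w uvw Pv P⊆v with unique-block⇒avoids u v w uvw P⊆v
  ... | ¬Pu , ¬Pw = begin
    filter P? (u ++ v ++ w)                   ≡⟨ filter-++₃ P? u v w ⟩
    filter P? u ++ filter P? v ++ filter P? w ≡⟨ cong₂ (λ a b → a ++ filter P? v ++ b)
                                                       (filter-none P? ¬Pu) (filter-none P? ¬Pw) ⟩
    filter P? v ++ []                         ≡⟨ ++-identityʳ _ ⟩
    filter P? v                               ≡⟨ filter-all P? Pv ⟩
    v                                         ∎
    where open ≡-Reasoning

<⇒<ᵇ≡true : ∀ {m n} → m < n → (m <ᵇ n) ≡ true
<⇒<ᵇ≡true {zero}  {suc n} _       = refl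
<⇒<ᵇ≡true {suc m} {suc n} (s<s p) = <⇒<ᵇ≡true p

≤⇒<ᵇ≡false : ∀ {m n} → n ≤ m → (m <ᵇ n) ≡ false
≤⇒<ᵇ≡false {m}     {zero}  _       = refl
≤⇒<ᵇ≡false {suc m} {suc n} (s≤s p) = ≤⇒<ᵇ≡false p

module _ {n : ℕ} where

  open DecMembership (F._≟_ {n}) public using () renaming (_∈?_ to _∈ˡ?_)

  infix 4 _≺⟨_⟩_
  _≺⟨_⟩_ : Fin n → List (Fin n) → Fin n → Bool
  x ≺⟨ l ⟩ y = pos x l <ᵇ pos y l

  pos-here : ∀ (x : Fin n) l → pos x (x ∷ l) ≡ 0
  pos-here x l with x F.≟ x
  ... | yes _  = refl
  ... | no x≢x = ⊥-elim (x≢x refl)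

  pos-there : ∀ {x z : Fin n} l → x ≢ z → pos x (z ∷ l) ≡ suc (pos x l)
  pos-there {x} {z} l x≢z with x F.≟ z
  ... | yes x≡z = ⊥-elim (x≢z x≡z)
  ... | no _    = refl

  pos<length : ∀ {x : Fin n} {l} → x ∈ l → pos x l < length l
  pos<length {x} {z ∷ l} x∈ with x F.≟ z | x∈
  ... | yes _   | _          = z<s
  ... | no  x≢z | here x≡z   = ⊥-elim (x≢z x≡z)
  ... | no  _   | there x∈l  = s<s (pos<length x∈l)

  pos-++ˡ : ∀ {x : Fin n} u v → x ∈ u → pos x (u ++ v) ≡ pos x u
  pos-++ˡ {x} (z ∷ u) v x∈ with x F.≟ z | x∈
  ... | yes _   | _         = refl
  ... | no  x≢z | here x≡z  = ⊥-elim (x≢z x≡z)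
  ... | no  _   | there x∈u = cong suc (pos-++ˡ u v x∈u)

  pos-++ʳ : ∀ {x : Fin n} u v → x ∉ u → pos x (u ++ v) ≡ length u + pos x v
  pos-++ʳ     []      v x∉ = refl
  pos-++ʳ {x} (z ∷ u) v x∉ with x F.≟ z
  ... | yes x≡z = ⊥-elim (x∉ (here x≡z))
  ... | no  _   = cong suc (pos-++ʳ u v (x∉ ∘ there))

  pos-injective : ∀ {x y : Fin n} l → x ∈ l → pos x l ≡ pos y l → x ≡ y
  pos-injective {x} {y} (z ∷ l) x∈ eq with x F.≟ z | y F.≟ z | x∈
  ... | yes x≡z | yes y≡z | _         = trans x≡z (sym y≡z)
  ... | yes _   | no  _   | _         = ⊥-elim (0≢1+n eq)
  ... | no  _   | yes _   | _         = ⊥-elim (0≢1+n (sym eq))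
  ... | no  x≢z | no  _   | here x≡z  = ⊥-elim (x≢z x≡z)
  ... | no  _   | no  _   | there x∈l = pos-injective l x∈l (suc-injective eq)

  ≺-irrefl : ∀ l (x : Fin n) → (x ≺⟨ l ⟩ x) ≡ false
  ≺-irrefl l x = ≤⇒<ᵇ≡false {pos x l} ℕP.≤-refl

  ≺-flip : ∀ {l} {x y : Fin n} → x ∈ l → x ≢ y → (y ≺⟨ l ⟩ x) ≡ not (x ≺⟨ l ⟩ y)
  ≺-flip {l} {x} {y} x∈l x≢y with ℕP.<-cmp (pos x l) (pos y l)
  ... | tri< p _ _ = trans (≤⇒<ᵇ≡false (<⇒≤ p)) (cong not (sym (<⇒<ᵇ≡true p)))
  ... | tri≈ _ p _ = ⊥-elim (x≢y (pos-injective l x∈l p))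
  ... | tri> _ _ p = trans (<⇒<ᵇ≡true p) (cong not (sym (≤⇒<ᵇ≡false (<⇒≤ p))))

  ≺-filter : ∀ {p} {P : Pred (Fin n) p} (P? : Decidable P) {x y} → P x → P y →
             ∀ l → (x ≺⟨ filter P? l ⟩ y) ≡ (x ≺⟨ l ⟩ y)
  ≺-filter P?         px py []      = refl
  ≺-filter {P = P} P? {x} {y} px py (z ∷ l) with P? z
  ... | no ¬pz = trans (≺-filter P? px py l) (sym (cong₂ _<ᵇ_ (pos-there l (≢z px)) (pos-there l (≢z py))))
    where
    ≢z : ∀ {v} → P v → v ≢ z
    ≢z pv refl = ¬pz pv
  ... | yes _ with x F.≟ z | y F.≟ z
  ... | yes _ | yes _ = refl
  ... | yes _ | no _  = refl
  ... | no _  | yes _ = refl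
  ... | no _  | no _  = ≺-filter P? px py l

  block-≺ : ∀ {x y : Fin n} u v w → x ∉ u → x ∈ v → y ∉ v →
            (x ≺⟨ u ++ v ++ w ⟩ y) ≡ not (does (y ∈ˡ? u))
  block-≺ {x} {y} u v w x∉u x∈v y∉v with y ∈ˡ? u
  ... | yes y∈u = ≤⇒<ᵇ≡false (begin
    pos y (u ++ v ++ w)       ≡⟨ pos-++ˡ u _ y∈u ⟩
    pos y u                   ≤⟨ <⇒≤ (pos<length y∈u) ⟩
    length u                  ≤⟨ m≤m+n _ _ ⟩
    length u + pos x (v ++ w) ≡⟨ pos-++ʳ u _ x∉u ⟨
    pos x (u ++ v ++ w)       ∎)
    where open ℕP.≤-Reasoning
  ... | no y∉u = <⇒<ᵇ≡true (begin-strict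
    pos x (u ++ v ++ w)              ≡⟨ pos-++ʳ u _ x∉u ⟩
    length u + pos x (v ++ w)        ≡⟨ cong (length u +_) (pos-++ˡ v w x∈v) ⟩
    length u + pos x v               <⟨ +-monoʳ-< (length u) (pos<length x∈v) ⟩
    length u + length v              ≤⟨ +-monoʳ-≤ (length u) (m≤m+n _ _) ⟩
    length u + (length v + pos y w)  ≡⟨ cong (length u +_) (pos-++ʳ v w y∉v) ⟨
    length u + pos y (v ++ w)        ≡⟨ pos-++ʳ u _ y∉u ⟨
    pos y (u ++ v ++ w)              ∎)
    where open ℕP.≤-Reasoning

  ≺-block : ∀ {x y : Fin n} u v w → x ∉ v → y ∉ u → y ∈ v →
            (x ≺⟨ u ++ v ++ w ⟩ y) ≡ does (x ∈ˡ? u)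
  ≺-block {x} {y} u v w x∉v y∉u y∈v with x ∈ˡ? u
  ... | yes x∈u = <⇒<ᵇ≡true (begin-strict
    pos x (u ++ v ++ w)       ≡⟨ pos-++ˡ u _ x∈u ⟩
    pos x u                   <⟨ pos<length x∈u ⟩
    length u                  ≤⟨ m≤m+n _ _ ⟩
    length u + pos y (v ++ w) ≡⟨ pos-++ʳ u _ y∉u ⟨
    pos y (u ++ v ++ w)       ∎)
    where open ℕP.≤-Reasoning
  ... | no x∉u = ≤⇒<ᵇ≡false (begin
    pos y (u ++ v ++ w)             ≡⟨ pos-++ʳ u _ y∉u ⟩
    length u + pos y (v ++ w)       ≡⟨ cong (length u +_) (pos-++ˡ v w y∈v) ⟩
    length u + pos y v              ≤⟨ +-monoʳ-≤ (length u) (<⇒≤ (pos<length y∈v)) ⟩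
    length u + length v             ≤⟨ +-monoʳ-≤ (length u) (m≤m+n _ _) ⟩
    length u + (length v + pos x w) ≡⟨ cong (length u +_) (pos-++ʳ v w x∉v) ⟨
    length u + pos x (v ++ w)       ≡⟨ pos-++ʳ u _ x∉u ⟨
    pos x (u ++ v ++ w)             ∎)
    where open ℕP.≤-Reasoning

  block-≺-representative : ∀ {x c y : Fin n} u v w → Unique (u ++ v ++ w) → x ∈ v → c ∈ v → y ∉ v →
                           (x ≺⟨ u ++ v ++ w ⟩ y) ≡ (c ≺⟨ u ++ v ++ w ⟩ y)
  block-≺-representative u v w uvw x∈v c∈v y∉v =
    trans (block-≺ u v w (λ x∈u → unique-++⇒disjoint u uvw (x∈u , ∈-++⁺ˡ x∈v)) x∈v y∉v)
          (sym (block-≺ u v w (λ c∈u → unique-++⇒disjoint u uvw (c∈u , ∈-++⁺ˡ c∈v)) c∈v y∉v))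

  ≺-block-representative : ∀ {x c y : Fin n} u v w → Unique (u ++ v ++ w) → y ∉ v → x ∈ v → c ∈ v →
                           (y ≺⟨ u ++ v ++ w ⟩ x) ≡ (y ≺⟨ u ++ v ++ w ⟩ c)
  ≺-block-representative u v w uvw y∉v x∈v c∈v =
    trans (≺-block u v w y∉v (λ x∈u → unique-++⇒disjoint u uvw (x∈u , ∈-++⁺ˡ x∈v)) x∈v)
          (sym (≺-block u v w y∉v (λ c∈u → unique-++⇒disjoint u uvw (c∈u , ∈-++⁺ˡ c∈v)) c∈v))

-- Crossing numbers as double sums over all characters

listSum : ∀ {A : Set} → List A → (A → ℕ) → ℕ
listSum []       f = 0
listSum (x ∷ xs) f = f x + listSum xs f

syntax listSum l (λ x → e) = ∑[ x ∈ l ] e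

listSum-cong : ∀ {A : Set} (l : List A) {f g : A → ℕ} → (∀ {x} → x ∈ l → f x ≡ g x) →
               ∑[ x ∈ l ] f x ≡ ∑[ x ∈ l ] g x
listSum-cong []      eq = refl
listSum-cong (x ∷ l) eq = cong₂ _+_ (eq (here refl)) (listSum-cong l (eq ∘ there))

module _ {n : ℕ} where

  length-filter≡∑ : (b : Fin n → Bool) (l : List (Fin n)) →
                  length (filter (λ y → T? (b y)) l) ≡ ∑[ y ∈ l ] ⟦ b y ⟧
  length-filter≡∑ b []      = refl
  length-filter≡∑ b (x ∷ l) with b x
  ... | true  = cong suc (length-filter≡∑ b l)
  ... | false = length-filter≡∑ b l

  listSum-unique : ∀ {p : List (Fin n)} (f : Fin n → ℕ) → Unique p →
                   ∑[ x ∈ p ] f x ≡ ∑[ x < n ] ⟦ does (x ∈ˡ? p) ⟧· f x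
  listSum-unique {[]}    f _             = sym (sum-replicate-zero n)
  listSum-unique {z ∷ p} f u@(z∉p ∷ up) = begin
    f z + ∑[ x ∈ p ] f x
      ≡⟨ cong₂ _+_ (∑-δ z f) (sym (listSum-unique f up)) ⟨
    ∑[ x < n ] ⟦ does (x F.≟ z) ⟧· f x + ∑[ x < n ] ⟦ does (x ∈ˡ? p) ⟧· f x
      ≡⟨ ∑-distrib-+ {n} _ _ ⟨
    ∑[ x < n ] (⟦ does (x F.≟ z) ⟧· f x + ⟦ does (x ∈ˡ? p) ⟧· f x)
      ≡⟨ sum-cong-≗ split ⟩
    ∑[ x < n ] ⟦ does (x ∈ˡ? z ∷ p) ⟧· f x ∎
    where
    open ≡-Reasoning
    split : ∀ x → ⟦ does (x F.≟ z) ⟧· f x + ⟦ does (x ∈ˡ? p) ⟧· f x ≡ ⟦ does (x ∈ˡ? z ∷ p) ⟧· f x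
    split x with x F.≟ z | x ∈ˡ? p | x ∈ˡ? z ∷ p
    ... | yes refl | yes x∈p | _                = ⊥-elim (All.lookup z∉p x∈p refl)
    ... | yes refl | no _    | yes _            = +-identityʳ _
    ... | yes refl | no _    | no x∉            = ⊥-elim (x∉ (here refl))
    ... | no _     | yes _   | yes _            = refl
    ... | no _     | yes x∈p | no x∉            = ⊥-elim (x∉ (there x∈p))
    ... | no x≢z   | no _    | yes (here x≡z)   = ⊥-elim (x≢z x≡z)
    ... | no _     | no x∉p  | yes (there x∈p) = ⊥-elim (x∉p x∈p)
    ... | no _     | no _    | no _             = refl

  crossPairs-unique : ∀ {p} (q : List (Fin n)) → Unique p →
                      crossPairs p q ≡ ∑[ x ∈ p ] ∑[ y ∈ p ] ⟦ (x ≺⟨ p ⟩ y) ∧ (y ≺⟨ q ⟩ x) ⟧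
  crossPairs-unique {[]}     q _               = refl
  crossPairs-unique {z ∷ xs} q (z∉xs ∷ uxs) =
    cong₂ _+_ head-term (trans (crossPairs-unique q uxs) (listSum-cong xs tail-terms))
    where
    ≢z : ∀ {y} → y ∈ xs → y ≢ z
    ≢z y∈ refl = All.lookup z∉xs y∈ refl
    head-term : length (filter (λ y → T? (pos y q <ᵇ pos z q)) xs) ≡
                ∑[ y ∈ z ∷ xs ] ⟦ (z ≺⟨ z ∷ xs ⟩ y) ∧ (y ≺⟨ q ⟩ z) ⟧
    head-term rewrite ≺-irrefl (z ∷ xs) z | pos-here z xs =
      trans (length-filter≡∑ (λ y → pos y q <ᵇ pos z q) xs)
            (listSum-cong xs (λ y∈ → cong (λ b → ⟦ (0 <ᵇ b) ∧ _ ⟧) (sym (pos-there xs (≢z y∈)))))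
    tail-terms : ∀ {x} → x ∈ xs → ∑[ y ∈ xs ] ⟦ (x ≺⟨ xs ⟩ y) ∧ (y ≺⟨ q ⟩ x) ⟧ ≡
                 ∑[ y ∈ z ∷ xs ] ⟦ (x ≺⟨ z ∷ xs ⟩ y) ∧ (y ≺⟨ q ⟩ x) ⟧
    tail-terms {x} x∈ rewrite pos-here z xs | pos-there xs (≢z x∈) =
      listSum-cong xs (λ y∈ → cong (λ b → ⟦ (suc (pos x xs) <ᵇ b) ∧ _ ⟧) (sym (pos-there xs (≢z y∈))))

  crossPairs-filter : ∀ {p} {P : Pred (Fin n) p} (P? : Decidable P) (π π' : List (Fin n)) →
                      Unique π → (∀ {x} → P x → x ∈ π) →
                      crossPairs (filter P? π) (filter P? π') ≡
                      ∑∑ (λ x y → ⟦ does (P? x) ⟧· ⟦ does (P? y) ⟧· ⟦ (x ≺⟨ π ⟩ y) ∧ (y ≺⟨ π' ⟩ x) ⟧)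
  crossPairs-filter P? π π' uπ P⊆π = begin
    crossPairs fπ fπ'
      ≡⟨ crossPairs-unique fπ' ufπ ⟩
    ∑[ x ∈ fπ ] ∑[ y ∈ fπ ] ⟦ (x ≺⟨ fπ ⟩ y) ∧ (y ≺⟨ fπ' ⟩ x) ⟧
      ≡⟨ listSum-unique _ ufπ ⟩
    ∑[ x < n ] ⟦ does (x ∈ˡ? fπ) ⟧· (∑[ y ∈ fπ ] ⟦ (x ≺⟨ fπ ⟩ y) ∧ (y ≺⟨ fπ' ⟩ x) ⟧)
      ≡⟨ sum-cong-≗ (λ x → cong₂ ⟦_⟧·_ (∈fπ x) (listSum-unique _ ufπ)) ⟩
    ∑[ x < n ] ⟦ does (P? x) ⟧·
      (∑[ y < n ] ⟦ does (y ∈ˡ? fπ) ⟧· ⟦ (x ≺⟨ fπ ⟩ y) ∧ (y ≺⟨ fπ' ⟩ x) ⟧)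
      ≡⟨ sum-cong-≗ (λ x → trans (⟦⟧·-∑ {n} (does (P? x)) _) (sum-cong-≗ (λ y → unfiltered x y))) ⟩
    ∑[ x < n ] ∑[ y < n ] ⟦ does (P? x) ⟧· ⟦ does (P? y) ⟧· ⟦ (x ≺⟨ π ⟩ y) ∧ (y ≺⟨ π' ⟩ x) ⟧ ∎
    where
    open ≡-Reasoning
    fπ fπ' : List (Fin n)
    fπ  = filter P? π
    fπ' = filter P? π'
    ufπ : Unique fπ
    ufπ = Unique.filter⁺ P? uπ
    ∈fπ : ∀ x → does (x ∈ˡ? fπ) ≡ does (P? x)
    ∈fπ x with x ∈ˡ? fπ | P? x
    ... | yes _  | yes _  = refl
    ... | yes x∈ | no ¬px = ⊥-elim (¬px (proj₂ (∈-filter⁻ P? {xs = π} x∈)))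
    ... | no x∉  | yes px = ⊥-elim (x∉ (∈-filter⁺ P? (P⊆π px) px))
    ... | no _   | no _   = refl
    unfiltered : ∀ x y →
      ⟦ does (P? x) ⟧· ⟦ does (y ∈ˡ? fπ) ⟧· ⟦ (x ≺⟨ fπ ⟩ y) ∧ (y ≺⟨ fπ' ⟩ x) ⟧ ≡
      ⟦ does (P? x) ⟧· ⟦ does (P? y) ⟧· ⟦ (x ≺⟨ π ⟩ y) ∧ (y ≺⟨ π' ⟩ x) ⟧
    unfiltered x y rewrite ∈fπ y =
      ⟦⟧·-cong (does (P? x)) λ px → ⟦⟧·-cong (does (P? y)) λ py →
        cong₂ (λ a b → ⟦ a ∧ b ⟧) (≺-filter P? (witness (P? x) px) (witness (P? y) py) π)
                                   (≺-filter P? (witness (P? y) py) (witness (P? x) px) π')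

-- Descents of a Boolean sequence inside a window of steps

-- inWindow i j s holds iff i ≤ s < j; the recursion makes it commute with shifting i, j and s by one.
inWindow : ℕ → ℕ → ℕ → Bool
inWindow zero    j       s       = s <ᵇ j
inWindow (suc i) j       zero    = false
inWindow (suc i) zero    (suc s) = false
inWindow (suc i) (suc j) (suc s) = inWindow i j s

inWindow-complete : ∀ {i j s} → i ≤ s → s < j → inWindow i j s ≡ true
inWindow-complete {zero}                    _       s<j       = <⇒<ᵇ≡true s<j
inWindow-complete {suc i} {suc j} {suc s} (s≤s i≤s) (s<s s<j) = inWindow-complete i≤s s<j

inWindow-sound : ∀ {i j s} → T (inWindow i j s) → i ≤ s × s < j
inWindow-sound {zero}  {j}     {s}     w = z≤n , <ᵇ⇒< s j w
inWindow-sound {suc i} {suc j} {suc s} w with inWindow-sound {i} {j} {s} w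
... | i≤s , s<j = s≤s i≤s , s<s s<j

inWindow-outside : ∀ {i j s} → T (not (inWindow i j s)) → s < i ⊎ j ≤ s
inWindow-outside {i} {j} {s} w with s ℕP.<? i | j ℕP.≤? s
... | yes s<i | _       = inj₁ s<i
... | no _    | yes j≤s = inj₂ j≤s
... | no s≮i  | no j≰s  rewrite inWindow-complete (ℕP.≮⇒≥ s≮i) (ℕP.≰⇒> j≰s) = ⊥-elim w

descent : (ℕ → Bool) → ℕ → ℕ
descent G s = ⟦ G s ∧ not (G (suc s)) ⟧

windowDescents : ℕ → ℕ → ℕ → (ℕ → Bool) → ℕ
windowDescents i j k G = ∑[ s < k ] ⟦ inWindow i j (toℕ s) ⟧· descent G (toℕ s)

⟦∧not⟧-triangle : ∀ a b c → ⟦ a ∧ not c ⟧ ≤ ⟦ a ∧ not b ⟧ + ⟦ b ∧ not c ⟧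
⟦∧not⟧-triangle true  true  true  = z≤n
⟦∧not⟧-triangle true  true  false = s≤s z≤n
⟦∧not⟧-triangle true  false true  = z≤n
⟦∧not⟧-triangle true  false false = s≤s z≤n
⟦∧not⟧-triangle false b     c     = z≤n

windowDescents-≥ : ∀ k i j G → i ≤ j → j ≤ k → ⟦ G i ∧ not (G j) ⟧ ≤ windowDescents i j k G
windowDescents-≥ k       zero    zero    G _ _ rewrite ∧-inverseʳ (G 0) = z≤n
windowDescents-≥ (suc k) zero    (suc j) G _ (s≤s j≤k) =
  ℕP.≤-trans (⟦∧not⟧-triangle (G 0) (G 1) (G (suc j)))
             (+-monoʳ-≤ (descent G 0) (windowDescents-≥ k zero j (G ∘ suc) z≤n j≤k))
windowDescents-≥ (suc k) (suc i) (suc j) G (s≤s i≤j) (s≤s j≤k) = windowDescents-≥ k i j (G ∘ suc) i≤j j≤k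

windowDescents-constant : ∀ k i j G → i < j → (∀ s → i ≤ s → s < j → G s ≡ G i) →
                          windowDescents i j k G ≤ ⟦ G i ∧ not (G j) ⟧
windowDescents-constant zero    i       j             G _         _     = z≤n
windowDescents-constant (suc k) zero    (suc zero)    G _         _
  rewrite sum-replicate-zero k = ℕP.≤-reflexive (+-identityʳ _)
windowDescents-constant (suc k) zero    (suc (suc j)) G _         const = begin
  descent G 0 + W           ≡⟨ cong (λ b → ⟦ G 0 ∧ not b ⟧ + W) G₁≡G₀ ⟩
  ⟦ G 0 ∧ not (G 0) ⟧ + W   ≡⟨ cong (λ b → ⟦ b ⟧ + W) (∧-inverseʳ (G 0)) ⟩
  W                         ≤⟨ windowDescents-constant k zero (suc j) (G ∘ suc) z<s
                                 (λ s _ s<j → trans (const (suc s) z≤n (s<s s<j)) (sym G₁≡G₀)) ⟩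
  ⟦ G 1 ∧ not (G (2 + j)) ⟧ ≡⟨ cong (λ b → ⟦ b ∧ not (G (2 + j)) ⟧) G₁≡G₀ ⟩
  ⟦ G 0 ∧ not (G (2 + j)) ⟧ ∎
  where
  open ℕP.≤-Reasoning
  W : ℕ
  W = windowDescents 0 (suc j) k (G ∘ suc)
  G₁≡G₀ : G 1 ≡ G 0
  G₁≡G₀ = const 1 z≤n (s<s z<s)
windowDescents-constant (suc k) (suc i) (suc j) G (s<s i<j) const =
  windowDescents-constant k i j (G ∘ suc) i<j (λ s i≤s s<j → const (suc s) (s≤s i≤s) (s<s s<j))

clamp : ∀ {L} .{{_ : ℕ.NonZero L}} → ℕ → Fin L
clamp {suc zero}    _       = F.zero
clamp {suc (suc k)} zero    = F.zero
clamp {suc (suc k)} (suc s) = F.suc (clamp s)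

clamp-toℕ : ∀ {L} .{{_ : ℕ.NonZero L}} (t : Fin L) → clamp (toℕ t) ≡ t
clamp-toℕ {suc zero}    F.zero    = refl
clamp-toℕ {suc (suc k)} F.zero    = refl
clamp-toℕ {suc (suc k)} (F.suc t) = cong F.suc (clamp-toℕ t)

toℕ-clamp : ∀ {L} .{{_ : ℕ.NonZero L}} {s} → s < L → toℕ (clamp {L} s) ≡ s
toℕ-clamp s<L = trans (cong toℕ (trans (cong clamp (sym (FP.toℕ-fromℕ< s<L))) (clamp-toℕ _)))
                      (FP.toℕ-fromℕ< s<L)

consecutiveSum-clamp : ∀ {L} .{{_ : ℕ.NonZero L}} (f : Fin L → Fin L → ℕ) →
                       consecutiveSum f ≡ ∑[ s < ℕ.pred L ] f (clamp (toℕ s)) (clamp (suc (toℕ s)))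
consecutiveSum-clamp {suc k} f = trans (sum-map-allFin k _) (sum-cong-≗ λ s →
  sym (cong₂ f (trans (cong clamp (sym (FP.toℕ-inject₁ s))) (clamp-toℕ _)) (clamp-toℕ (F.suc s))))

∑⟨_⟩_ : ∀ {n} → (Fin n → Bool) → (Fin n → ℕ) → ℕ
∑⟨_⟩_ {n} c f = ∑[ x < n ] ⟦ c x ⟧· f x

module _ {n : ℕ} where

  ∑-partition : ∀ (c : Fin n → Bool) f → ∑[ x < n ] f x ≡ ∑⟨ c ⟩ f + ∑⟨ not ∘ c ⟩ f
  ∑-partition c f = trans (sum-cong-≗ (λ x → ⟦⟧·-split (c x) (f x))) (∑-distrib-+ {n} _ _)

  ∑⟨⟩-distrib-+ : ∀ (c : Fin n → Bool) f g → ∑⟨ c ⟩ (λ x → f x + g x) ≡ ∑⟨ c ⟩ f + ∑⟨ c ⟩ g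
  ∑⟨⟩-distrib-+ c f g = trans (sum-cong-≗ (λ x → ⟦⟧·-distrib-+ (c x) (f x) (g x))) (∑-distrib-+ {n} _ _)

  ∑⟨⟩-cong : ∀ (c : Fin n → Bool) {f g} → (∀ x → T (c x) → f x ≡ g x) → ∑⟨ c ⟩ f ≡ ∑⟨ c ⟩ g
  ∑⟨⟩-cong c eq = sum-cong-≗ (λ x → ⟦⟧·-cong (c x) (eq x))

  ∑⟨⟩-mono-≤ : ∀ (c : Fin n → Bool) {f g} → (∀ x → T (c x) → f x ≤ g x) → ∑⟨ c ⟩ f ≤ ∑⟨ c ⟩ g
  ∑⟨⟩-mono-≤ c le = ∑-mono-≤ (λ x → ⟦⟧·-mono-≤ (c x) (le x))

  ∑⟨⟩-comm : ∀ (c d : Fin n → Bool) (F : Fin n → Fin n → ℕ) →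
             ∑⟨ c ⟩ (λ x → ∑⟨ d ⟩ (F x)) ≡ ∑⟨ d ⟩ (λ y → ∑⟨ c ⟩ (λ x → F x y))
  ∑⟨⟩-comm c d F = begin
    ∑[ x < n ] ⟦ c x ⟧· (∑[ y < n ] ⟦ d y ⟧· F x y) ≡⟨ sum-cong-≗ (λ x → ⟦⟧·-∑ {n} (c x) _) ⟩
    ∑[ x < n ] ∑[ y < n ] ⟦ c x ⟧· ⟦ d y ⟧· F x y   ≡⟨ ∑-comm {n} {n} _ ⟩
    ∑[ y < n ] ∑[ x < n ] ⟦ c x ⟧· ⟦ d y ⟧· F x y
      ≡⟨ sum-cong-≗ (λ y → sum-cong-≗ (λ x → ⟦⟧·-comm (c x) (d y) _)) ⟩
    ∑[ y < n ] ∑[ x < n ] ⟦ d y ⟧· ⟦ c x ⟧· F x y   ≡⟨ sum-cong-≗ (λ y → ⟦⟧·-∑ {n} (d y) _) ⟨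
    ∑[ y < n ] ⟦ d y ⟧· (∑[ x < n ] ⟦ c x ⟧· F x y) ∎
    where open ≡-Reasoning

module _ {n : ℕ} (b : Fin n → Bool) where

  mixedCost : (Fin n → Fin n → ℕ) → Fin n → ℕ
  mixedCost H x = ∑⟨ not ∘ b ⟩ (λ y → H x y + H y x)

  ∑∑-quadrants : ∀ (H : Fin n → Fin n → ℕ) →
                 ∑∑ H ≡ ∑⟨ b ⟩ (λ x → ∑⟨ b ⟩ H x) + ∑⟨ b ⟩ mixedCost H
                        + ∑⟨ not ∘ b ⟩ (λ x → ∑⟨ not ∘ b ⟩ H x)
  ∑∑-quadrants H = begin
    ∑[ x < n ] ∑[ y < n ] H x y
      ≡⟨ sum-cong-≗ (λ x → ∑-partition b (H x)) ⟩
    ∑[ x < n ] (∑⟨ b ⟩ H x + ∑⟨ ¬b ⟩ H x)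
      ≡⟨ ∑-partition b _ ⟩
    ∑⟨ b ⟩ (λ x → ∑⟨ b ⟩ H x + ∑⟨ ¬b ⟩ H x) + ∑⟨ ¬b ⟩ (λ x → ∑⟨ b ⟩ H x + ∑⟨ ¬b ⟩ H x)
      ≡⟨ cong₂ _+_ (∑⟨⟩-distrib-+ b _ _) (∑⟨⟩-distrib-+ ¬b _ _) ⟩
    (BB + BN) + (NB + NN)
      ≡⟨ ℕP.+-assoc BB BN (NB + NN) ⟩
    BB + (BN + (NB + NN))
      ≡⟨ cong (BB +_) (ℕP.+-assoc BN NB NN) ⟨
    BB + ((BN + NB) + NN)
      ≡⟨ ℕP.+-assoc BB (BN + NB) NN ⟨
    BB + (BN + NB) + NN
      ≡⟨ cong (λ m → BB + m + NN) mixed ⟨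
    BB + ∑⟨ b ⟩ mixedCost H + NN ∎
    where
    open ≡-Reasoning
    ¬b : Fin n → Bool
    ¬b = not ∘ b
    BB BN NB NN : ℕ
    BB = ∑⟨ b ⟩ (λ x → ∑⟨ b ⟩ H x)
    BN = ∑⟨ b ⟩ (λ x → ∑⟨ ¬b ⟩ H x)
    NB = ∑⟨ ¬b ⟩ (λ x → ∑⟨ b ⟩ H x)
    NN = ∑⟨ ¬b ⟩ (λ x → ∑⟨ ¬b ⟩ H x)
    mixed : ∑⟨ b ⟩ mixedCost H ≡ BN + NB
    mixed = trans (∑⟨⟩-cong b (λ x _ → ∑⟨⟩-distrib-+ ¬b (H x) (λ y → H y x)))
           (trans (∑⟨⟩-distrib-+ b _ _) (cong (BN +_) (∑⟨⟩-comm b ¬b (λ x y → H y x))))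

  -- The two mixed quadrants of H' add up to ∑⟨ b ⟩ (λ _ → mixedCost H c), which the choice of c
  -- keeps below the mixed part ∑⟨ b ⟩ mixedCost H of H.
  ∑∑-≤-representative :
    ∀ (H' H : Fin n → Fin n → ℕ) c →
    (∀ x y → T (b x) → T (b y) → H' x y ≤ H x y) →
    (∀ x y → T (b x) → T (not (b y)) → H' x y ≡ H c y) →
    (∀ x y → T (not (b x)) → T (b y) → H' x y ≡ H x c) →
    (∀ x y → T (not (b x)) → T (not (b y)) → H' x y ≡ H x y) →
    (∀ x → T (b x) → mixedCost H c ≤ mixedCost H x) →
    ∑∑ H' ≤ ∑∑ H
  ∑∑-≤-representative H' H c bb bn nb nn c-min = begin
    ∑∑ H'
      ≡⟨ ∑∑-quadrants H' ⟩
    ∑⟨ b ⟩ (λ x → ∑⟨ b ⟩ H' x) + ∑⟨ b ⟩ mixedCost H' + ∑⟨ not ∘ b ⟩ (λ x → ∑⟨ not ∘ b ⟩ H' x)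
      ≤⟨ +-mono-≤ (+-mono-≤ (∑⟨⟩-mono-≤ b (λ x bx → ∑⟨⟩-mono-≤ b (λ y → bb x y bx)))
                            (∑⟨⟩-mono-≤ b (λ x bx → ℕP.≤-trans (ℕP.≤-reflexive (mixed-rep x bx)) (c-min x bx))))
                  (ℕP.≤-reflexive (∑⟨⟩-cong (not ∘ b) (λ x ¬bx → ∑⟨⟩-cong (not ∘ b) (λ y → nn x y ¬bx)))) ⟩
    ∑⟨ b ⟩ (λ x → ∑⟨ b ⟩ H x) + ∑⟨ b ⟩ mixedCost H + ∑⟨ not ∘ b ⟩ (λ x → ∑⟨ not ∘ b ⟩ H x)
      ≡⟨ ∑∑-quadrants H ⟨
    ∑∑ H ∎
    where
    open ℕP.≤-Reasoning
    mixed-rep : ∀ x → T (b x) → mixedCost H' x ≡ mixedCost H c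
    mixed-rep x bx = ∑⟨⟩-cong (not ∘ b) (λ y ¬by → cong₂ _+_ (bn x y bx ¬by) (nb y x ¬by bx))

-- Gathering a set of characters at the position of one of them

module Gather {n : ℕ} (C : Subset n) (c : Fin n) (ω : List (Fin n)) where

  gatherStep : Fin n → List (Fin n)
  gatherStep x with x F.≟ c | x ∈ₛ? C
  ... | yes _ | _     = ω
  ... | no _  | yes _ = []
  ... | no _  | no _  = [ x ]

  gather : List (Fin n) → List (Fin n)
  gather = concatMap gatherStep

  outside : List (Fin n) → List (Fin n)
  outside = filter (∁? (_∈ₛ? C))

  gather-++ : ∀ u v → gather (u ++ v) ≡ gather u ++ gather v
  gather-++ u v = concatMap-++ gatherStep u v

  gather-++₃ : ∀ u v w → gather (u ++ v ++ w) ≡ gather u ++ gather v ++ gather w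
  gather-++₃ u v w = trans (gather-++ u (v ++ w)) (cong (gather u ++_) (gather-++ v w))

  gather-without : ∀ {a} → c ∉ a → gather a ≡ outside a
  gather-without {[]}    _   = refl
  gather-without {x ∷ a} c∉ with x F.≟ c | x ∈ₛ? C
  ... | yes refl | _       = ⊥-elim (c∉ (here refl))
  ... | no _     | yes _    = gather-without (c∉ ∘ there)
  ... | no _     | no _     = cong (x ∷_) (gather-without (c∉ ∘ there))

  gather-at : ∀ {a b} → c ∉ a → c ∉ b → gather (a ++ c ∷ b) ≡ outside a ++ ω ++ outside b
  gather-at {a} {b} c∉a c∉b = begin
    gather (a ++ c ∷ b)            ≡⟨ gather-++ a (c ∷ b) ⟩
    gather a ++ gather (c ∷ b)     ≡⟨ cong₂ _++_ (gather-without c∉a) (cong (_++ gather b) step-c) ⟩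
    outside a ++ ω ++ gather b     ≡⟨ cong (λ r → outside a ++ ω ++ r) (gather-without c∉b) ⟩
    outside a ++ ω ++ outside b    ∎
    where
    open ≡-Reasoning
    step-c : gatherStep c ≡ ω
    step-c with c F.≟ c
    ... | yes _  = refl
    ... | no c≢c = ⊥-elim (c≢c refl)

  gather-view : ∀ {l} → Unique l → c ∈ l →
                ∃₂ λ a b → l ≡ a ++ c ∷ b × c ∉ a × gather l ≡ outside a ++ ω ++ outside b
  gather-view ul c∈l with unique-split ul c∈l
  ... | a , b , eq , c∉a , c∉b = a , b , eq , c∉a , trans (cong gather eq) (gather-at c∉a c∉b)

  ∈-outside⁻ : ∀ {x} a → x ∈ outside a → x ∉ₛ C × x ∈ a
  ∈-outside⁻ a x∈ = swap (∈-filter⁻ (∁? (_∈ₛ? C)) {xs = a} x∈)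

  ∈-outside⁺ : ∀ {x} a → x ∉ₛ C → x ∈ a → x ∈ outside a
  ∈-outside⁺ a x∉C x∈a = ∈-filter⁺ (∁? (_∈ₛ? C)) {xs = a} x∈a x∉C

  does-∈-outside : ∀ {x} a → x ∉ₛ C → does (x ∈ˡ? outside a) ≡ does (x ∈ˡ? a)
  does-∈-outside {x} a x∉C with x ∈ˡ? outside a | x ∈ˡ? a
  ... | yes _  | yes _  = refl
  ... | no _   | no _   = refl
  ... | yes x∈ | no x∉  = ⊥-elim (x∉ (proj₂ (∈-outside⁻ a x∈)))
  ... | no x∉  | yes x∈ = ⊥-elim (x∉ (∈-outside⁺ a x∉C x∈))

  module Valid (c∈C : c ∈ₛ C) (ω⊆C : All (_∈ₛ C) ω) where

    gather-outside : ∀ {a} → All (_∉ₛ C) a → gather a ≡ a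
    gather-outside {a} a∉C =
      trans (gather-without (λ c∈a → All.lookup a∉C c∈a c∈C)) (filter-all (∁? (_∈ₛ? C)) a∉C)

    ω∩outside : ∀ {x} a → x ∈ ω → x ∉ outside a
    ω∩outside a x∈ω x∈ = proj₁ (∈-outside⁻ a x∈) (All.lookup ω⊆C x∈ω)

    ∈-gather⁻ : ∀ {x l} → Unique l → c ∈ l → x ∈ gather l → x ∈ ω ⊎ (x ∉ₛ C × x ∈ l)
    ∈-gather⁻ ul c∈l x∈ with gather-view ul c∈l
    ... | a , b , refl , _ , eq with ∈-++⁻ (outside a) (subst (_ ∈_) eq x∈)
    ... | inj₁ x∈a = inj₂ (proj₁ (∈-outside⁻ a x∈a) , ∈-++⁺ˡ (proj₂ (∈-outside⁻ a x∈a)))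
    ... | inj₂ x∈ with ∈-++⁻ ω x∈
    ...   | inj₁ x∈ω = inj₁ x∈ω
    ...   | inj₂ x∈b = inj₂ (proj₁ (∈-outside⁻ b x∈b) , ∈-++⁺ʳ a (there (proj₂ (∈-outside⁻ b x∈b))))

    ∈-gather⁺ˡ : ∀ {x l} → Unique l → c ∈ l → x ∈ ω → x ∈ gather l
    ∈-gather⁺ˡ ul c∈l x∈ω with gather-view ul c∈l
    ... | a , b , refl , _ , eq = subst (_ ∈_) (sym eq) (∈-++⁺ʳ (outside a) (∈-++⁺ˡ x∈ω))

    ∈-gather⁺ʳ : ∀ {x l} → Unique l → c ∈ l → x ∉ₛ C → x ∈ l → x ∈ gather l
    ∈-gather⁺ʳ ul c∈l x∉C x∈l with gather-view ul c∈l
    ... | a , b , refl , _ , eq with ∈-++⁻ a x∈l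
    ... | inj₁ x∈a         = subst (_ ∈_) (sym eq) (∈-++⁺ˡ (∈-outside⁺ a x∉C x∈a))
    ... | inj₂ (here refl) = ⊥-elim (x∉C c∈C)
    ... | inj₂ (there x∈b) = subst (_ ∈_) (sym eq) (∈-++⁺ʳ (outside a) (∈-++⁺ʳ ω (∈-outside⁺ b x∉C x∈b)))

    gather-unique : ∀ {l} → Unique l → c ∈ l → Unique ω → Unique (gather l)
    gather-unique ul c∈l uω with gather-view ul c∈l
    ... | a , b , refl , _ , eq = subst Unique (sym eq)
      (Unique.++⁺ (Unique.filter⁺ _ (unique-++⁻ˡ a ul))
                  (Unique.++⁺ uω (Unique.filter⁺ _ (unique-++⁻ʳ [ c ] (unique-++⁻ʳ a ul)))
                              (λ (x∈ω , x∈b) → ω∩outside b x∈ω x∈b))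
                  (λ (x∈a , x∈) → [ (λ x∈ω → ω∩outside a x∈ω x∈a)
                                   , (λ x∈b → unique-++⇒disjoint a ul
                                        (proj₂ (∈-outside⁻ a x∈a) , there (proj₂ (∈-outside⁻ b x∈b)))) ]′
                                   (∈-++⁻ ω x∈)))

    module _ {p} {P : Pred (Fin n) p} (P? : Decidable P) where

      filter-gather-disjoint : (∀ {x} → P x → x ∉ₛ C) → ∀ {l} → Unique l → c ∈ l →
                               filter P? (gather l) ≡ filter P? l
      filter-gather-disjoint P∩C=∅ ul c∈l with gather-view ul c∈l
      ... | a , b , refl , _ , eq = begin
        filter P? (gather (a ++ c ∷ b))                          ≡⟨ cong (filter P?) eq ⟩
        filter P? (outside a ++ ω ++ outside b)                  ≡⟨ filter-++₃ P? (outside a) ω (outside b) ⟩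
        filter P? (outside a) ++ filter P? ω ++ filter P? (outside b)
          ≡⟨ cong₂ (λ u w → u ++ w) (filter-filter P? _ P∩C=∅ a)
                   (cong₂ _++_ (filter-none P? (All.map (λ x∈C Px → P∩C=∅ Px x∈C) ω⊆C))
                               (filter-filter P? _ P∩C=∅ b)) ⟩
        filter P? a ++ filter P? b
          ≡⟨ cong (filter P? a ++_) (filter-reject P? (λ Pc → P∩C=∅ Pc c∈C)) ⟨
        filter P? a ++ filter P? (c ∷ b)                         ≡⟨ filter-++ P? a (c ∷ b) ⟨
        filter P? (a ++ c ∷ b)                                   ∎
        where open ≡-Reasoning

      filter-gather-⊆ : (∀ {x} → P x → x ∈ₛ C) → ∀ {l} → Unique l → c ∈ l →
                        filter P? (gather l) ≡ filter P? ω
      filter-gather-⊆ P⊆C ul c∈l with gather-view ul c∈l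
      ... | a , b , refl , _ , eq = begin
        filter P? (gather (a ++ c ∷ b))                          ≡⟨ cong (filter P?) eq ⟩
        filter P? (outside a ++ ω ++ outside b)                  ≡⟨ filter-++₃ P? (outside a) ω (outside b) ⟩
        filter P? (outside a) ++ filter P? ω ++ filter P? (outside b)
          ≡⟨ cong₂ (λ u w → u ++ filter P? ω ++ w) (filter-none P? (none a)) (filter-none P? (none b)) ⟩
        filter P? ω ++ []                                        ≡⟨ ++-identityʳ _ ⟩
        filter P? ω                                              ∎
        where
        open ≡-Reasoning
        none : ∀ u → All (∁ P) (outside u)
        none u = All.tabulate (λ x∈ Px → proj₁ (∈-outside⁻ u x∈) (P⊆C Px))

      filter-gather-⊇ : (∀ {x} → x ∈ₛ C → P x) → ∀ {l} → Unique l → c ∈ l →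
                        filter P? (gather l) ≡ gather (filter P? l)
      filter-gather-⊇ C⊆P ul c∈l with gather-view ul c∈l
      ... | a , b , refl , c∉a , eq = begin
        filter P? (gather (a ++ c ∷ b))                           ≡⟨ cong (filter P?) eq ⟩
        filter P? (outside a ++ ω ++ outside b)                   ≡⟨ filter-++₃ P? (outside a) ω (outside b) ⟩
        filter P? (outside a) ++ filter P? ω ++ filter P? (outside b)
          ≡⟨ cong₂ (λ u w → u ++ w) (filter-comm P? _ a)
                   (cong₂ _++_ (filter-all P? (All.map C⊆P ω⊆C)) (filter-comm P? _ b)) ⟩
        outside (filter P? a) ++ ω ++ outside (filter P? b)
          ≡⟨ gather-at (c∉a ∘ filter-⊆ a) (c∉b ∘ filter-⊆ b) ⟨
        gather (filter P? a ++ c ∷ filter P? b)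
          ≡⟨ cong (λ r → gather (filter P? a ++ r)) (filter-accept P? (C⊆P c∈C)) ⟨
        gather (filter P? a ++ filter P? (c ∷ b))                 ≡⟨ cong gather (filter-++ P? a (c ∷ b)) ⟨
        gather (filter P? (a ++ c ∷ b))                           ∎
        where
        open ≡-Reasoning
        filter-⊆ : ∀ u {x} → x ∈ filter P? u → x ∈ u
        filter-⊆ u x∈ = proj₁ (∈-filter⁻ P? {xs = u} x∈)
        c∉b : c ∉ b
        c∉b c∈b = unique-++⇒disjoint (a ++ [ c ]) (subst Unique (sym (++-assoc a [ c ] b)) ul)
                    (∈-++⁺ʳ a (here refl) , c∈b)

    gather-ω : Unique ω → c ∈ ω → gather ω ≡ ω
    gather-ω uω c∈ω with gather-view uω c∈ω
    ... | a , b , ω≡ , _ , eq = begin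
      gather ω                      ≡⟨ eq ⟩
      outside a ++ ω ++ outside b   ≡⟨ cong₂ (λ u w → u ++ ω ++ w) (filter-none _ (inside (∈-++⁺ˡ {ys = c ∷ b})))
                                                                  (filter-none _ (inside (∈-++⁺ʳ a ∘ there))) ⟩
      ω ++ []                       ≡⟨ ++-identityʳ ω ⟩
      ω                             ∎
      where
      open ≡-Reasoning
      inside : ∀ {u} → (∀ {x} → x ∈ u → x ∈ a ++ c ∷ b) → All (λ x → ¬ (x ∉ₛ C)) u
      inside u⊆ = All.tabulate (λ x∈u x∉C → x∉C (All.lookup ω⊆C (subst (_ ∈_) (sym ω≡) (u⊆ x∈u))))

    gather-block : ∀ {u w} → All (_∉ₛ C) u → All (_∉ₛ C) w → Unique ω → c ∈ ω →
                   gather (u ++ ω ++ w) ≡ u ++ ω ++ w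
    gather-block {u} {w} u∉C w∉C uω c∈ω = begin
      gather (u ++ ω ++ w)              ≡⟨ gather-++ u (ω ++ w) ⟩
      gather u ++ gather (ω ++ w)       ≡⟨ cong (gather u ++_) (gather-++ ω w) ⟩
      gather u ++ gather ω ++ gather w  ≡⟨ cong₂ (λ p q → p ++ gather ω ++ q)
                                                   (gather-outside u∉C) (gather-outside w∉C) ⟩
      u ++ gather ω ++ w                ≡⟨ cong (λ r → u ++ r ++ w) (gather-ω uω c∈ω) ⟩
      u ++ ω ++ w                       ∎
      where open ≡-Reasoning

    ≺-gather-outside : ∀ {x y l} → x ∉ₛ C → y ∉ₛ C → Unique l → c ∈ l →
                       (x ≺⟨ gather l ⟩ y) ≡ (x ≺⟨ l ⟩ y)
    ≺-gather-outside {x} {y} {l} x∉C y∉C ul c∈l = begin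
      x ≺⟨ gather l ⟩ y            ≡⟨ ≺-filter (∁? (_∈ₛ? C)) x∉C y∉C (gather l) ⟨
      x ≺⟨ outside (gather l) ⟩ y  ≡⟨ cong (λ r → x ≺⟨ r ⟩ y)
                                            (filter-gather-disjoint (∁? (_∈ₛ? C)) (λ z → z) ul c∈l) ⟩
      x ≺⟨ outside l ⟩ y           ≡⟨ ≺-filter (∁? (_∈ₛ? C)) x∉C y∉C l ⟩
      x ≺⟨ l ⟩ y                   ∎
      where open ≡-Reasoning

    ≺-gather-inside : ∀ {x y l} → x ∈ₛ C → y ∈ₛ C → Unique l → c ∈ l →
                      (x ≺⟨ gather l ⟩ y) ≡ (x ≺⟨ ω ⟩ y)
    ≺-gather-inside {x} {y} {l} x∈C y∈C ul c∈l = begin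
      x ≺⟨ gather l ⟩ y                      ≡⟨ ≺-filter (_∈ₛ? C) x∈C y∈C (gather l) ⟨
      x ≺⟨ filter (_∈ₛ? C) (gather l) ⟩ y   ≡⟨ cong (λ r → x ≺⟨ r ⟩ y)
                                                     (filter-gather-⊆ (_∈ₛ? C) (λ z → z) ul c∈l) ⟩
      x ≺⟨ filter (_∈ₛ? C) ω ⟩ y            ≡⟨ ≺-filter (_∈ₛ? C) x∈C y∈C ω ⟩
      x ≺⟨ ω ⟩ y                             ∎
      where open ≡-Reasoning

    gather-≺ : ∀ {x y l} → x ∈ ω → y ∉ₛ C → Unique l → c ∈ l → (x ≺⟨ gather l ⟩ y) ≡ (c ≺⟨ l ⟩ y)
    gather-≺ {x} {y} x∈ω y∉C ul c∈l with gather-view ul c∈l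
    ... | a , b , refl , c∉a , eq = begin
      x ≺⟨ gather (a ++ c ∷ b) ⟩ y          ≡⟨ cong (λ r → x ≺⟨ r ⟩ y) eq ⟩
      x ≺⟨ outside a ++ ω ++ outside b ⟩ y  ≡⟨ block-≺ (outside a) ω (outside b) (ω∩outside a x∈ω) x∈ω
                                                        (λ y∈ω → y∉C (All.lookup ω⊆C y∈ω)) ⟩
      not (does (y ∈ˡ? outside a))          ≡⟨ cong not (does-∈-outside a y∉C) ⟩
      not (does (y ∈ˡ? a))                  ≡⟨ block-≺ a [ c ] b c∉a (here refl) (λ { (here refl) → y∉C c∈C }) ⟨
      c ≺⟨ a ++ c ∷ b ⟩ y                   ∎
      where open ≡-Reasoning

    ≺-gather : ∀ {x y l} → x ∉ₛ C → y ∈ ω → Unique l → c ∈ l → (x ≺⟨ gather l ⟩ y) ≡ (x ≺⟨ l ⟩ c)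
    ≺-gather {x} {y} x∉C y∈ω ul c∈l with gather-view ul c∈l
    ... | a , b , refl , c∉a , eq = begin
      x ≺⟨ gather (a ++ c ∷ b) ⟩ y          ≡⟨ cong (λ r → x ≺⟨ r ⟩ y) eq ⟩
      x ≺⟨ outside a ++ ω ++ outside b ⟩ y
        ≡⟨ ≺-block (outside a) ω (outside b) (λ x∈ω → x∉C (All.lookup ω⊆C x∈ω)) (ω∩outside a y∈ω) y∈ω ⟩
      does (x ∈ˡ? outside a)                ≡⟨ does-∈-outside a x∉C ⟩
      does (x ∈ˡ? a)                        ≡⟨ ≺-block a [ c ] b (λ { (here refl) → x∉C c∈C }) c∉a (here refl) ⟨
      x ≺⟨ a ++ c ∷ b ⟩ c                   ∎
      where open ≡-Reasoning

    gather-disjoint-block : ∀ u {v} w → All (_∉ₛ C) v → gather (u ++ v ++ w) ≡ gather u ++ v ++ gather w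
    gather-disjoint-block u {v} w v∉C =
      trans (gather-++ u (v ++ w)) (cong (gather u ++_) (trans (gather-++ v w) (cong (_++ gather w) (gather-outside v∉C))))

    ∈-gather-⊇ : ∀ {D : Subset n} {v} → (∀ {x} → x ∈ₛ C → x ∈ ω) → Unique v → c ∈ v → C ⊆ₛ D →
                 (∀ {x} → x ∈ v → x ∈ₛ D) → (∀ {x} → x ∈ₛ D → x ∈ v) →
                 ∀ x → (x ∈ gather v → x ∈ₛ D) × (x ∈ₛ D → x ∈ gather v)
    ∈-gather-⊇ {D} {v} C⊆ω uv c∈v C⊆D v⊆D D⊆v x = to , from
      where
      to : x ∈ gather v → x ∈ₛ D
      to x∈ = [ (λ x∈ω → C⊆D (All.lookup ω⊆C x∈ω)) , (λ (_ , x∈v) → v⊆D x∈v) ]′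
              (∈-gather⁻ uv c∈v x∈)
      from : x ∈ₛ D → x ∈ gather v
      from x∈D with x ∈ₛ? C
      ... | yes x∈C = ∈-gather⁺ˡ uv c∈v (C⊆ω x∈C)
      ... | no x∉C  = ∈-gather⁺ʳ uv c∈v x∉C (D⊆v x∈D)

-- Repairing finitely many items in order of rank

module Sweep {X A : Set} (rank : A → ℕ) (fix : A → X → X) (Fixed : A → X → Set)
             (fix-fixes : ∀ a x → Fixed a (fix a x))
             (fix-keeps : ∀ a b x → rank b ≤ rank a → Fixed b x → Fixed b (fix a x))
             (items : List A) where

  fixRank : ℕ → A → X → X
  fixRank r a x with rank a ℕP.≟ r
  ... | yes _ = fix a x
  ... | no  _ = x

  pass : ℕ → List A → X → X
  pass r []       x = x
  pass r (a ∷ as) x = pass r as (fixRank r a x)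

  sweep : ℕ → X → X
  sweep zero    x = x
  sweep (suc r) x = pass r items (sweep r x)

  pass-keeps : ∀ {r b} as x → rank b ≤ r → Fixed b x → Fixed b (pass r as x)
  pass-keeps         []       x b≤r fixed = fixed
  pass-keeps {r} {b} (a ∷ as) x b≤r fixed = pass-keeps as _ b≤r (fixRank-keeps a)
    where
    fixRank-keeps : ∀ a → Fixed b (fixRank r a x)
    fixRank-keeps a with rank a ℕP.≟ r
    ... | yes refl = fix-keeps a b x b≤r fixed
    ... | no  _    = fixed

  pass-fixes : ∀ {r a} as x → a ∈ as → rank a ≡ r → Fixed a (pass r as x)
  pass-fixes {r} {a} (a ∷ as) x (here refl) refl = pass-keeps as _ ℕP.≤-refl fixRank-fixes
    where
    fixRank-fixes : Fixed a (fixRank (rank a) a x)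
    fixRank-fixes with rank a ℕP.≟ rank a
    ... | yes _ = fix-fixes a x
    ... | no ≢  = ⊥-elim (≢ refl)
  pass-fixes (_ ∷ as) x (there a∈as) eq = pass-fixes as _ a∈as eq

  sweep-fixes : ∀ n x {a} → a ∈ items → rank a < n → Fixed a (sweep n x)
  sweep-fixes (suc r) x a∈ a<1+r with ℕP.m<1+n⇒m<n∨m≡n a<1+r
  ... | inj₁ a<r = pass-keeps items _ (<⇒≤ a<r) (sweep-fixes r x a∈ a<r)
  ... | inj₂ a≡r = pass-fixes items _ a∈ a≡r

  module _ (_⊑_ : X → X → Set) (⊑-refl : ∀ {x} → x ⊑ x) (⊑-trans : ∀ {x y z} → x ⊑ y → y ⊑ z → x ⊑ z)
           (fix-⊑ : ∀ a x → fix a x ⊑ x) where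

    sweep-⊑ : ∀ n x → sweep n x ⊑ x
    sweep-⊑ zero    x = ⊑-refl
    sweep-⊑ (suc r) x = ⊑-trans (pass-⊑ items (sweep r x)) (sweep-⊑ r x)
      where
      fixRank-⊑ : ∀ a y → fixRank r a y ⊑ y
      fixRank-⊑ a y with rank a ℕP.≟ r
      ... | yes _ = fix-⊑ a y
      ... | no  _ = ⊑-refl
      pass-⊑ : ∀ as y → pass r as y ⊑ y
      pass-⊑ []       y = ⊑-refl
      pass-⊑ (a ∷ as) y = ⊑-trans (pass-⊑ as (fixRank r a y)) (fixRank-⊑ a y)

module Storyline (Ins : Instance) where

  open Instance Ins using (time; char; char⊆AC; disjoint; Active; active?) renaming (ℓ to L; n to N; m to M)

  active-between : ∀ {c a b t} → Active c a → Active c b → a F.≤ t → t F.≤ b → Active c t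
  active-between (lo≤a , _) (_ , b≤hi) a≤t t≤b = ℕP.≤-trans lo≤a a≤t , ℕP.≤-trans t≤b b≤hi

  same-interaction : ∀ {I I' c} → time I ≡ time I' → c ∈ₛ char I → c ∈ₛ char I' → I ≡ I'
  same-interaction {I} {I'} {c} tI≡tI' c∈I c∈I' with I F.≟ I'
  ... | yes I≡I' = I≡I'
  ... | no  I≢I' = ⊥-elim (disjoint I I' I≢I' tI≡tI' c c∈I c∈I')

  quiet-meets⇒⊆ : ∀ {k D I z} → Quiet {Ins} k D → time I ≡ k → z ∈ₛ D → z ∈ₛ char I → D ⊆ₛ char I
  quiet-meets⇒⊆ (inj₁ untouched)           tI≡k z∈D z∈I = ⊥-elim (untouched _ tI≡k _ z∈I z∈D)
  quiet-meets⇒⊆ (inj₂ (I' , tI'≡k , D⊆I')) tI≡k z∈D z∈I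
    with same-interaction (trans tI'≡k (sym tI≡k)) (D⊆I' z∈D) z∈I
  ... | refl = D⊆I'

  quiet-⊆ : ∀ {k C D} → D ⊆ₛ C → Quiet {Ins} k C → Quiet {Ins} k D
  quiet-⊆ D⊆C (inj₁ untouched)         = inj₁ (λ I' eq c c∈I' c∈D → untouched I' eq c c∈I' (D⊆C c∈D))
  quiet-⊆ D⊆C (inj₂ (I' , eq , C⊆I')) = inj₂ (I' , eq , C⊆I' ∘ D⊆C)

  module _ (S : Solution Ins) where

    perm-unique : ∀ t → Unique (perm S t)
    perm-unique t = proj₁ (isPerm S t)

    ∈-perm⁺ : ∀ {c t} → Active c t → c ∈ perm S t
    ∈-perm⁺ {c} {t} = proj₂ (proj₂ (isPerm S t) c)

    ∈-perm⁻ : ∀ {c t} → c ∈ perm S t → Active c t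
    ∈-perm⁻ {c} {t} = proj₁ (proj₂ (isPerm S t) c)

  both-active? : ∀ t t' → Decidable (λ c → Active c t × Active c t')
  both-active? t t' c = active? c t ×-dec active? c t'

  module _ .{{_ : ℕ.NonZero L}} where

    crossingAt : (Fin L → List (Fin N)) → ℕ → Fin N → Fin N → ℕ
    crossingAt p s x y =
      ⟦ does (both-active? (clamp s) (clamp (suc s)) x) ⟧· ⟦ does (both-active? (clamp s) (clamp (suc s)) y) ⟧·
      ⟦ (x ≺⟨ p (clamp s) ⟩ y) ∧ (y ≺⟨ p (clamp (suc s)) ⟩ x) ⟧

    cr-as-∑ : ∀ (R : Solution Ins) →
              cr R ≡ ∑[ x < N ] ∑[ y < N ] ∑[ s < ℕ.pred L ] crossingAt (perm R) (toℕ s) x y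
    cr-as-∑ R = begin
      cr R
        ≡⟨ consecutiveSum-clamp (crStep R) ⟩
      ∑[ s < ℕ.pred L ] crStep R (clamp (toℕ s)) (clamp (suc (toℕ s)))
        ≡⟨ sum-cong-≗ {ℕ.pred L} (λ s → let t = clamp (toℕ s) ; t' = clamp (suc (toℕ s)) in
             crossPairs-filter (both-active? t t') (perm R t) (perm R t') (perm-unique R t) (∈-perm⁺ R ∘ proj₁)) ⟩
      ∑[ s < ℕ.pred L ] ∑[ x < N ] ∑[ y < N ] crossingAt (perm R) (toℕ s) x y
        ≡⟨ ∑-comm {ℕ.pred L} {N} (λ s x → ∑[ y < N ] crossingAt (perm R) (toℕ s) x y) ⟩
      ∑[ x < N ] ∑[ s < ℕ.pred L ] ∑[ y < N ] crossingAt (perm R) (toℕ s) x y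
        ≡⟨ sum-cong-≗ {N} (λ x → ∑-comm {ℕ.pred L} {N} (λ s y → crossingAt (perm R) (toℕ s) x y)) ⟩
      ∑[ x < N ] ∑[ y < N ] ∑[ s < ℕ.pred L ] crossingAt (perm R) (toℕ s) x y ∎
      where open ≡-Reasoning

  module Window (S : Solution Ins) {I₁ I₂ : Fin M} (pair : Type2Pair {Ins} I₁ I₂) where

    C : Subset N
    C = char I₁

    ti tj : Fin L
    ti = time I₁
    tj = time I₂

    π : Fin L → List (Fin N)
    π = perm S

    ω : List (Fin N)
    ω = restrict (π ti) C

    C≡C₂ : C ≡ char I₂
    C≡C₂ = proj₁ pair

    ti<tj : ti F.< tj
    ti<tj = proj₁ (proj₂ pair)

    quiet : ∀ k → ti F.< k → k F.< tj → Quiet {Ins} k C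
    quiet = proj₂ (proj₂ pair)

    C-active : ∀ {x t} → x ∈ₛ C → ti F.≤ t → t F.≤ tj → Active x t
    C-active x∈C = active-between (char⊆AC I₁ _ x∈C) (char⊆AC I₂ _ (subst (_ ∈ₛ_) C≡C₂ x∈C))

    ω⊆C : All (_∈ₛ C) ω
    ω⊆C = All.all-filter (_∈ₛ? C) (π ti)

    C⊆ω : ∀ {x} → x ∈ₛ C → x ∈ ω
    C⊆ω x∈C = ∈-filter⁺ (_∈ₛ? C) (∈-perm⁺ S (char⊆AC I₁ _ x∈C)) x∈C

    ω-unique : Unique ω
    ω-unique = Unique.filter⁺ (_∈ₛ? C) (perm-unique S ti)

    ω-block : ∃₂ λ u w → π ti ≡ u ++ ω ++ w × All (_∉ₛ C) u × All (_∉ₛ C) w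
    ω-block with consec S I₁
    ... | u , v , w , eq , v≈C = u , w , trans eq (cong (λ r → u ++ r ++ w) (sym ω≡v)) ,
                                  unique-block⇒avoids u v w uvw (proj₂ (v≈C _))
      where
      uvw : Unique (u ++ v ++ w)
      uvw = subst Unique eq (perm-unique S ti)
      ω≡v : ω ≡ v
      ω≡v = trans (cong (λ l → restrict l C) eq)
                  (filter-block (_∈ₛ? C) u v w uvw (All.tabulate (proj₁ (v≈C _))) (proj₂ (v≈C _)))

    Inside : Fin L → Set
    Inside t = ti F.< t × t F.< tj

    ti-outside : ¬ Inside ti
    ti-outside (ti<ti , _) = FP.<-irrefl refl ti<ti

    tj-outside : ¬ Inside tj
    tj-outside (_ , tj<tj) = FP.<-irrefl refl tj<tj

    inside? : ∀ t → Dec (Inside t)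
    inside? t = (ti F.<? t) ×-dec (t F.<? tj)

    endpoint-block : ∀ {t} → ti F.≤ t → t F.≤ tj → ¬ Inside t → Consecutive Ins (π t) C
    endpoint-block {t} ti≤t t≤tj out with ti F.<? t
    ... | no ti≮t = subst (λ t → Consecutive Ins (π t) C) (FP.≤-antisym ti≤t (ℕP.≮⇒≥ ti≮t)) (consec S I₁)
    ... | yes ti<t with t F.<? tj
    ...   | yes t<tj = ⊥-elim (out (ti<t , t<tj))
    ...   | no  t≮tj = subst (λ t → Consecutive Ins (π t) C) (FP.≤-antisym (ℕP.≮⇒≥ t≮tj) t≤tj)
                             (subst (Consecutive Ins (π tj)) (sym C≡C₂) (consec S I₂))

    instance
      L-nonZero : ℕ.NonZero L
      L-nonZero = FP.nonZeroIndex ti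

    inWindowStep : Fin (ℕ.pred L) → Bool
    inWindowStep s = inWindow (toℕ ti) (toℕ tj) (toℕ s)

    windowCrossings outsideCrossings : (Fin L → List (Fin N)) → Fin N → Fin N → ℕ
    windowCrossings  p x y = ∑⟨ inWindowStep ⟩ (λ s → crossingAt p (toℕ s) x y)
    outsideCrossings p x y = ∑⟨ not ∘ inWindowStep ⟩ (λ s → crossingAt p (toℕ s) x y)

    cr-split : ∀ (R : Solution Ins) → cr R ≡ ∑∑ (windowCrossings (perm R)) + ∑∑ (outsideCrossings (perm R))
    cr-split R = trans (cr-as-∑ R) (trans (sum-cong-≗ {N} split-row) (∑-distrib-+ {N} _ _))
      where
      split-row : ∀ x → ∑[ y < N ] ∑[ s < ℕ.pred L ] crossingAt (perm R) (toℕ s) x y ≡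
                        ∑[ y < N ] windowCrossings (perm R) x y + ∑[ y < N ] outsideCrossings (perm R) x y
      split-row x = trans (sum-cong-≗ {N} (λ y → ∑-partition inWindowStep (λ s → crossingAt (perm R) (toℕ s) x y)))
                          (∑-distrib-+ {N} (windowCrossings (perm R) x) (outsideCrossings (perm R) x))

    inC : Fin N → Bool
    inC x = does (x ∈ₛ? C)

    pivotCost : Fin N → ℕ
    pivotCost = mixedCost inC (windowCrossings π)

    module Step {s} (w : T (inWindow (toℕ ti) (toℕ tj) s)) where

      s<j : s < toℕ tj
      s<j = proj₂ (inWindow-sound {toℕ ti} w)

      toℕ-now : toℕ (clamp {L} s) ≡ s
      toℕ-now = toℕ-clamp {L} (ℕP.<-trans s<j (FP.toℕ<n tj))

      toℕ-next : toℕ (clamp {L} (suc s)) ≡ suc s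
      toℕ-next = toℕ-clamp {L} (ℕP.≤-<-trans s<j (FP.toℕ<n tj))

      ti≤now : ti F.≤ clamp {L} s
      ti≤now = ℕP.≤-trans (proj₁ (inWindow-sound {toℕ ti} w)) (ℕP.≤-reflexive (sym toℕ-now))

      now≤tj : clamp {L} s F.≤ tj
      now≤tj = ℕP.≤-trans (ℕP.≤-reflexive toℕ-now) (<⇒≤ s<j)

      ti≤next : ti F.≤ clamp {L} (suc s)
      ti≤next = ℕP.≤-trans (ℕP.m≤n⇒m≤1+n (proj₁ (inWindow-sound {toℕ ti} w))) (ℕP.≤-reflexive (sym toℕ-next))

      next≤tj : clamp {L} (suc s) F.≤ tj
      next≤tj = ℕP.≤-trans (ℕP.≤-reflexive toℕ-next) s<j

      C-active-step : ∀ {x} → x ∈ₛ C → Active x (clamp {L} s) × Active x (clamp {L} (suc s))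
      C-active-step x∈C = C-active x∈C ti≤now now≤tj , C-active x∈C ti≤next next≤tj

    crossingAt-descent : ∀ (R : Solution Ins) {s x y} → T (inWindow (toℕ ti) (toℕ tj) s) → x ∈ₛ C → y ∈ₛ C →
                         crossingAt (perm R) s x y ≡ descent (λ m → x ≺⟨ perm R (clamp m) ⟩ y) s
    crossingAt-descent R {s} {x} {y} w x∈C y∈C =
      trans (⟦⟧·-yes (both-active? _ _ x) (C-active-step x∈C) _)
            (trans (⟦⟧·-yes (both-active? _ _ y) (C-active-step y∈C) _) flip-next)
      where
      open Step w
      flip-next : ⟦ (x ≺⟨ perm R (clamp s) ⟩ y) ∧ (y ≺⟨ perm R (clamp (suc s)) ⟩ x) ⟧ ≡
                  ⟦ (x ≺⟨ perm R (clamp s) ⟩ y) ∧ not (x ≺⟨ perm R (clamp (suc s)) ⟩ y) ⟧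
      flip-next with x F.≟ y
      ... | yes refl rewrite ≺-irrefl (perm R (clamp s)) x = refl
      ... | no  x≢y  = cong (λ b → ⟦ (x ≺⟨ perm R (clamp s) ⟩ y) ∧ b ⟧)
                            (≺-flip (∈-perm⁺ R (proj₂ (C-active-step x∈C))) x≢y)

    windowCrossings-descents : ∀ (R : Solution Ins) {x y} → x ∈ₛ C → y ∈ₛ C →
      windowCrossings (perm R) x y ≡ windowDescents (toℕ ti) (toℕ tj) (ℕ.pred L) (λ m → x ≺⟨ perm R (clamp m) ⟩ y)
    windowCrossings-descents R x∈C y∈C = ∑⟨⟩-cong inWindowStep (λ s w → crossingAt-descent R w x∈C y∈C)

    module Repair (cs : Fin N) (cs∈C : cs ∈ₛ C) where

      open Gather C cs ω
      open Valid cs∈C ω⊆C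

      π' : Fin L → List (Fin N)
      π' t with inside? t
      ... | yes _ = gather (π t)
      ... | no  _ = π t

      π'-inside : ∀ {t} → Inside t → π' t ≡ gather (π t)
      π'-inside {t} ins with inside? t
      ... | yes _   = refl
      ... | no  out = ⊥-elim (out ins)

      π'-outside : ∀ {t} → ¬ Inside t → π' t ≡ π t
      π'-outside {t} out with inside? t
      ... | yes ins = ⊥-elim (out ins)
      ... | no  _   = refl

      cs∈π : ∀ {t} → Inside t → cs ∈ π t
      cs∈π (ti<t , t<tj) = ∈-perm⁺ S (C-active cs∈C (<⇒≤ ti<t) (<⇒≤ t<tj))

      π'-isPerm : ∀ t → IsPermOf Ins (π' t) t
      π'-isPerm t with inside? t
      ... | no  _   = isPerm S t
      ... | yes ins@(ti<t , t<tj) =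
        gather-unique (perm-unique S t) (cs∈π ins) ω-unique , λ x → to , from x
        where
        to : ∀ {x} → x ∈ gather (π t) → Active x t
        to x∈ = [ (λ x∈ω → C-active (All.lookup ω⊆C x∈ω) (<⇒≤ ti<t) (<⇒≤ t<tj))
                , (λ (_ , x∈π) → ∈-perm⁻ S x∈π) ]′
                (∈-gather⁻ (perm-unique S t) (cs∈π ins) x∈)
        from : ∀ x → Active x t → x ∈ gather (π t)
        from x act with x ∈ₛ? C
        ... | yes x∈C = ∈-gather⁺ˡ (perm-unique S t) (cs∈π ins) (C⊆ω x∈C)
        ... | no  x∉C = ∈-gather⁺ʳ (perm-unique S t) (cs∈π ins) x∉C (∈-perm⁺ S act)

      gather-consecutive : ∀ {I} → Inside (time I) → Consecutive Ins (gather (π (time I))) (char I)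
      gather-consecutive {I} ins with consec S I | FP.any? (λ z → (z ∈ₛ? C) ×-dec (z ∈ₛ? char I))
      ... | u , v , w , eq , v≈D | no C∩D=∅ =
        gather u , v , gather w ,
        trans (cong gather eq)
              (gather-disjoint-block u w (All.tabulate λ {x} x∈v x∈C → C∩D=∅ (x , x∈C , proj₁ (v≈D x) x∈v))) ,
        v≈D
      ... | u , v , w , eq , v≈D | yes (z , z∈C , z∈D) =
        gather u , gather v , gather w , trans (cong gather eq) (gather-++₃ u v w) ,
        ∈-gather-⊇ C⊆ω (unique-++⁻ˡ v (unique-++⁻ʳ u uvw)) (proj₂ (v≈D cs) (C⊆D cs∈C)) C⊆D
                   (proj₁ (v≈D _)) (proj₂ (v≈D _))
        where
        C⊆D : C ⊆ₛ char I
        C⊆D = quiet-meets⇒⊆ (quiet (time I) (proj₁ ins) (proj₂ ins)) refl z∈C z∈D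
        uvw : Unique (u ++ v ++ w)
        uvw = subst Unique eq (perm-unique S (time I))

      π'-consecutive : ∀ I → Consecutive Ins (π' (time I)) (char I)
      π'-consecutive I with inside? (time I)
      ... | yes ins = gather-consecutive ins
      ... | no  _   = consec S I

      repaired : Solution Ins
      repaired = record { perm = π' ; isPerm = π'-isPerm ; consec = π'-consecutive }

      gather-restrict-ti : ∀ {D} → C ⊆ₛ D → gather (restrict (π ti) D) ≡ restrict (π ti) D
      gather-restrict-ti {D} C⊆D with ω-block
      ... | u , w , eq , u∉C , w∉C = begin
        gather (restrict (π ti) D)                  ≡⟨ cong (λ l → gather (restrict l D)) eq ⟩
        gather (restrict (u ++ ω ++ w) D)           ≡⟨ cong gather split ⟩
        gather (restrict u D ++ ω ++ restrict w D)  ≡⟨ gather-block (avoid u∉C) (avoid w∉C) ω-unique (C⊆ω cs∈C) ⟩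
        restrict u D ++ ω ++ restrict w D           ≡⟨ split ⟨
        restrict (u ++ ω ++ w) D                    ≡⟨ cong (λ l → restrict l D) eq ⟨
        restrict (π ti) D                           ∎
        where
        open ≡-Reasoning
        split : restrict (u ++ ω ++ w) D ≡ restrict u D ++ ω ++ restrict w D
        split = trans (filter-++₃ (_∈ₛ? D) u ω w)
                      (cong (λ r → restrict u D ++ r ++ restrict w D) (filter-all (_∈ₛ? D) (All.map C⊆D ω⊆C)))
        avoid : ∀ {a} → All (_∉ₛ C) a → All (_∉ₛ C) (restrict a D)
        avoid {a} a∉C = All.tabulate (λ x∈ → All.lookup a∉C (proj₁ (∈-filter⁻ (_∈ₛ? D) {xs = a} x∈)))

      ω-at-ti : ω ≡ restrict (π' ti) C
      ω-at-ti = cong (λ l → restrict l C) (sym (π'-outside ti-outside))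

      repaired-consistent : Pair-consistent repaired I₁ I₂
      repaired-consistent k ti<k k<tj with gather-view (perm-unique S k) (cs∈π (ti<k , k<tj))
      ... | a , b , _ , _ , eq = outside a , outside b ,
        trans (π'-inside (ti<k , k<tj)) (trans eq (cong (λ r → outside a ++ r ++ outside b) ω-at-ti))

      module Earlier {Q₁ Q₂ : Fin M} (pairQ : Type2Pair {Ins} Q₁ Q₂) (tq≤ti : time Q₁ F.≤ ti)
                     (pc : Pair-consistent S Q₁ Q₂) where

        C' : Subset N
        C' = char Q₁

        tq : Fin L
        tq = time Q₁

        B : List (Fin N)
        B = restrict (π tq) C'

        B⊆C' : All (_∈ₛ C') B
        B⊆C' = All.all-filter (_∈ₛ? C') (π tq)

        C'⊆B : ∀ {x} → x ∈ₛ C' → x ∈ B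
        C'⊆B x∈C' = ∈-filter⁺ (_∈ₛ? C') (∈-perm⁺ S (char⊆AC Q₁ _ x∈C')) x∈C'

        B-unchanged : B ≡ restrict (π' tq) C'
        B-unchanged = cong (λ l → restrict l C')
                           (sym (π'-outside λ (ti<tq , _) → ℕP.<-irrefl refl (ℕP.<-≤-trans ti<tq tq≤ti)))

        restrict-B-block : ∀ {t} X Y → π t ≡ X ++ B ++ Y → restrict (π t) C' ≡ B
        restrict-B-block {t} X Y eq = trans (cong (λ l → restrict l C') eq)
          (filter-block (_∈ₛ? C') X B Y (subst Unique eq (perm-unique S t)) B⊆C' C'⊆B)

        B-at-ti : ti F.< time Q₂ → restrict (π ti) C' ≡ B
        B-at-ti ti<tq₂ with tq F.≟ ti
        ... | yes tq≡ti = cong (λ t → restrict (π t) C') (sym tq≡ti)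
        ... | no  tq≢ti with pc ti (FP.≤∧≢⇒< tq≤ti tq≢ti) ti<tq₂
        ...   | X , Y , eq = restrict-B-block X Y eq

        B-gathered : ti F.< time Q₂ → (C ⊆ₛ C') ⊎ (∀ {x} → x ∈ₛ C' → x ∉ₛ C) → gather B ≡ B
        B-gathered ti<tq₂ (inj₁ C⊆C') = begin
          gather B                  ≡⟨ cong gather (B-at-ti ti<tq₂) ⟨
          gather (restrict (π ti) C') ≡⟨ gather-restrict-ti C⊆C' ⟩
          restrict (π ti) C'        ≡⟨ B-at-ti ti<tq₂ ⟩
          B                         ∎
          where open ≡-Reasoning
        B-gathered ti<tq₂ (inj₂ C'∩C=∅) = gather-outside (All.map C'∩C=∅ B⊆C')

        -- Overlap without C ⊆ C' forces tq < ti, and quietness of Q₁ Q₂ at ti gives C' ⊆ C,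
        -- so B is a segment of ω.
        B-inside-ω : ∀ {z} → z ∈ₛ C → z ∈ₛ C' → ¬ (C ⊆ₛ C') → ti F.< time Q₂ →
                     ∃₂ λ X Y → ω ≡ X ++ B ++ Y
        B-inside-ω z∈C z∈C' C⊈C' ti<tq₂ with tq F.≟ ti
        ... | yes tq≡ti with same-interaction tq≡ti z∈C' z∈C
        ...   | refl = ⊥-elim (C⊈C' (λ x∈C → x∈C))
        B-inside-ω z∈C z∈C' C⊈C' ti<tq₂ | no tq≢ti with pc ti (FP.≤∧≢⇒< tq≤ti tq≢ti) ti<tq₂
        ... | X , Y , eq = restrict X C , restrict Y C , (begin
          ω                                       ≡⟨ cong (λ l → restrict l C) eq ⟩
          restrict (X ++ B ++ Y) C                ≡⟨ filter-++₃ (_∈ₛ? C) X B Y ⟩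
          restrict X C ++ restrict B C ++ restrict Y C
            ≡⟨ cong (λ r → restrict X C ++ r ++ restrict Y C) (filter-all (_∈ₛ? C) (All.map C'⊆C B⊆C')) ⟩
          restrict X C ++ B ++ restrict Y C       ∎)
          where
          open ≡-Reasoning
          C'⊆C : C' ⊆ₛ C
          C'⊆C = quiet-meets⇒⊆ (proj₂ (proj₂ pairQ) ti (FP.≤∧≢⇒< tq≤ti tq≢ti) ti<tq₂) refl z∈C' z∈C

        keeps-gathered : ∀ {k} → Inside k → k F.< time Q₂ → (C ⊆ₛ C') ⊎ (∀ {x} → x ∈ₛ C' → x ∉ₛ C) →
                         ∀ X Y → π k ≡ X ++ B ++ Y → ∃₂ λ X' Y' → π' k ≡ X' ++ B ++ Y'
        keeps-gathered {k} ins k<tq₂ C⊆C'⊎C∩C'=∅ X Y eq = gather X , gather Y , (begin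
          π' k                               ≡⟨ π'-inside ins ⟩
          gather (π k)                       ≡⟨ cong gather eq ⟩
          gather (X ++ B ++ Y)               ≡⟨ gather-++₃ X B Y ⟩
          gather X ++ gather B ++ gather Y   ≡⟨ cong (λ r → gather X ++ r ++ gather Y)
                                                     (B-gathered (FP.<-trans (proj₁ ins) k<tq₂) C⊆C'⊎C∩C'=∅) ⟩
          gather X ++ B ++ gather Y          ∎)
          where open ≡-Reasoning

        keeps-nested : ∀ {k z} → Inside k → k F.< time Q₂ → z ∈ₛ C → z ∈ₛ C' → ¬ (C ⊆ₛ C') →
                       ∃₂ λ X' Y' → π' k ≡ X' ++ B ++ Y'
        keeps-nested {k} ins k<tq₂ z∈C z∈C' C⊈C'
          with B-inside-ω z∈C z∈C' C⊈C' (FP.<-trans (proj₁ ins) k<tq₂) | gather-view (perm-unique S k) (cs∈π ins)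
        ... | X , Y , ω≡ | a , b , _ , _ , eq = outside a ++ X , Y ++ outside b , (begin
          π' k                                      ≡⟨ trans (π'-inside ins) eq ⟩
          outside a ++ ω ++ outside b               ≡⟨ cong (λ r → outside a ++ r ++ outside b) ω≡ ⟩
          outside a ++ (X ++ B ++ Y) ++ outside b   ≡⟨ ++-reassociate (outside a) X B Y (outside b) ⟩
          (outside a ++ X) ++ B ++ Y ++ outside b   ∎)
          where open ≡-Reasoning

        keeps-inside : ∀ {k} → Inside k → k F.< time Q₂ → ∀ X Y → π k ≡ X ++ B ++ Y →
                       ∃₂ λ X' Y' → π' k ≡ X' ++ B ++ Y'
        keeps-inside ins k<tq₂ X Y eq with FP.any? (λ z → (z ∈ₛ? C) ×-dec (z ∈ₛ? C')) | C ⊆ₛ? C'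
        ... | _                    | yes C⊆C' = keeps-gathered ins k<tq₂ (inj₁ C⊆C') X Y eq
        ... | no C∩C'=∅            | _        =
          keeps-gathered ins k<tq₂ (inj₂ λ x∈C' x∈C → C∩C'=∅ (_ , x∈C , x∈C')) X Y eq
        ... | yes (z , z∈C , z∈C') | no C⊈C'  = keeps-nested ins k<tq₂ z∈C z∈C' C⊈C'

      repaired-keeps : ∀ {Q₁ Q₂} → Type2Pair {Ins} Q₁ Q₂ → time Q₁ F.≤ ti →
                       Pair-consistent S Q₁ Q₂ → Pair-consistent repaired Q₁ Q₂
      repaired-keeps pairQ tq≤ti pc k tq<k k<tq₂ = keep (inside? k) (pc k tq<k k<tq₂)
        where
        open Earlier pairQ tq≤ti pc
        keep : Dec (Inside k) → ∃₂ (λ X Y → π k ≡ X ++ B ++ Y) →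
               ∃₂ λ X Y → π' k ≡ X ++ restrict (π' tq) C' ++ Y
        keep (no out)  (X , Y , eq) = X , Y , trans (π'-outside out) (trans eq (cong (λ r → X ++ r ++ Y) B-unchanged))
        keep (yes ins) (X , Y , eq) with keeps-inside ins k<tq₂ X Y eq
        ... | X' , Y' , eq' = X' , Y' , trans eq' (cong (λ r → X' ++ r ++ Y') B-unchanged)

      restrict-outside : ∀ {t} D → ¬ Inside t → restrict (π' t) D ≡ restrict (π t) D
      restrict-outside D out = cong (λ l → restrict l D) (π'-outside out)

      restrict-disjoint : ∀ t {D} → (∀ {x} → x ∈ₛ D → x ∉ₛ C) → restrict (π' t) D ≡ restrict (π t) D
      restrict-disjoint t {D} D∩C=∅ with inside? t
      ... | yes ins = filter-gather-disjoint (_∈ₛ? D) D∩C=∅ (perm-unique S t) (cs∈π ins)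
      ... | no  _   = refl

      restrict-⊇ : ∀ {t D} → C ⊆ₛ D → Inside t → restrict (π' t) D ≡ gather (restrict (π t) D)
      restrict-⊇ {t} {D} C⊆D ins = trans (cong (λ l → restrict l D) (π'-inside ins))
                                         (filter-gather-⊇ (_∈ₛ? D) C⊆D (perm-unique S t) (cs∈π ins))

      restrict-⊆ : ∀ {t D} → D ⊆ₛ C → Inside t → restrict (π' t) D ≡ restrict (π ti) D
      restrict-⊆ {t} {D} D⊆C ins = trans (cong (λ l → restrict l D) (π'-inside ins))
        (trans (filter-gather-⊆ (_∈ₛ? D) D⊆C (perm-unique S t) (cs∈π ins))
               (filter-filter (_∈ₛ? D) (_∈ₛ? C) D⊆C (π ti)))

      module Type1 (t1 : Type1Consistent S) {I₃ j₃} (start : IsStart {Ins} I₃ j₃) where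

        C₃ : Subset N
        C₃ = char I₃

        t₃ : Fin L
        t₃ = time I₃

        valid : ValidStart {Ins} I₃ j₃
        valid = proj₁ start

        old : ∀ k → j₃ F.≤ k → k F.≤ t₃ → restrict (π k) C₃ ≡ restrict (π t₃) C₃
        old = t1 I₃ j₃ start

        Goal : Fin L → Set
        Goal k = restrict (π' k) C₃ ≡ restrict (π' t₃) C₃

        before-ti : ∀ {k} → ¬ Inside k → Inside t₃ → k F.≤ t₃ → k F.≤ ti
        before-ti {k} out-k (_ , t₃<tj) k≤t₃ with ti F.<? k
        ... | yes ti<k = ⊥-elim (out-k (ti<k , ℕP.≤-<-trans k≤t₃ t₃<tj))
        ... | no  ti≮k = ℕP.≮⇒≥ ti≮k

        after-tj : ∀ {k} → Inside k → ¬ Inside t₃ → k F.≤ t₃ → tj F.≤ t₃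
        after-tj (ti<k , _) out-t₃ k≤t₃ with t₃ F.<? tj
        ... | yes t₃<tj = ⊥-elim (out-t₃ (ℕP.<-≤-trans ti<k k≤t₃ , t₃<tj))
        ... | no  t₃≮tj = ℕP.≮⇒≥ t₃≮tj

        -- I₂ touches C₃ at tj, so a quiet stretch of I₃ running across tj forces C₃ ⊆ C.
        meets-across-tj : ∀ {z} → j₃ F.< tj → tj F.≤ t₃ → z ∈ₛ C → z ∈ₛ C₃ → C₃ ⊆ₛ C
        meets-across-tj j₃<tj tj≤t₃ z∈C z∈C₃ = subst (C₃ ⊆ₛ_) (sym C≡C₂)
          (quiet-meets⇒⊆ {I = I₂} (proj₂ (proj₂ valid) tj j₃<tj tj≤t₃) refl z∈C₃
                                  (subst (_ ∈ₛ_) C≡C₂ z∈C))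

        ti-valid : C₃ ⊆ₛ C → ∀ {k} → j₃ F.≤ k → Inside k → k F.≤ t₃ → ValidStart {Ins} I₃ ti
        ti-valid C₃⊆C j₃≤k (ti<k , k<tj) k≤t₃ = <⇒≤ (ℕP.<-≤-trans ti<k k≤t₃) , active , quiet₃
          where
          active : ∀ k' → ti F.≤ k' → k' F.≤ t₃ → ∀ c → c ∈ₛ C₃ → Active c k'
          active k' ti≤k' k'≤t₃ c c∈C₃ =
            active-between (C-active (C₃⊆C c∈C₃) ℕP.≤-refl (<⇒≤ ti<tj)) (char⊆AC I₃ c c∈C₃) ti≤k' k'≤t₃
          quiet₃ : ∀ k' → ti F.< k' → k' F.≤ t₃ → Quiet {Ins} k' C₃
          quiet₃ k' ti<k' k'≤t₃ with k' F.<? tj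
          ... | yes k'<tj = quiet-⊆ C₃⊆C (quiet k' ti<k' k'<tj)
          ... | no  k'≮tj =
            proj₂ (proj₂ valid) k' (ℕP.≤-<-trans j₃≤k (ℕP.<-≤-trans k<tj (ℕP.≮⇒≥ k'≮tj))) k'≤t₃

        case-⊆ : C₃ ⊆ₛ C → ∀ {k} → j₃ F.≤ k → k F.≤ t₃ → Dec (Inside k) → Dec (Inside t₃) → Goal k
        case-⊆ C₃⊆C j₃≤k k≤t₃ (yes ins-k) (yes ins-t₃) =
          trans (restrict-⊆ C₃⊆C ins-k) (sym (restrict-⊆ C₃⊆C ins-t₃))
        case-⊆ C₃⊆C j₃≤k k≤t₃ (no out-k) (no out-t₃) =
          trans (restrict-outside C₃ out-k) (trans (old _ j₃≤k k≤t₃) (sym (restrict-outside C₃ out-t₃)))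
        case-⊆ C₃⊆C j₃≤k k≤t₃ (yes ins-k) (no out-t₃) =
          trans (restrict-⊆ C₃⊆C ins-k) (trans (old ti (proj₂ start ti ti-valid') (proj₁ ti-valid'))
                                               (sym (restrict-outside C₃ out-t₃)))
          where
          ti-valid' : ValidStart {Ins} I₃ ti
          ti-valid' = ti-valid C₃⊆C j₃≤k ins-k k≤t₃
        case-⊆ C₃⊆C j₃≤k k≤t₃ (no out-k) (yes ins-t₃@(ti<t₃ , _)) =
          trans (restrict-outside C₃ out-k)
                (trans (old _ j₃≤k k≤t₃)
                       (trans (sym (old ti (ℕP.≤-trans j₃≤k (before-ti out-k ins-t₃ k≤t₃)) (<⇒≤ ti<t₃)))
                              (sym (restrict-⊆ C₃⊆C ins-t₃))))

        case-⊇ : ¬ (C₃ ⊆ₛ C) → C ⊆ₛ C₃ →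
                 ∀ {k} → j₃ F.≤ k → k F.≤ t₃ → Dec (Inside k) → Dec (Inside t₃) → Goal k
        case-⊇ C₃⊈C C⊆C₃ j₃≤k k≤t₃ (yes ins-k) (yes ins-t₃) =
          trans (restrict-⊇ C⊆C₃ ins-k) (trans (cong gather (old _ j₃≤k k≤t₃)) (sym (restrict-⊇ C⊆C₃ ins-t₃)))
        case-⊇ C₃⊈C C⊆C₃ j₃≤k k≤t₃ (no out-k) (no out-t₃) =
          trans (restrict-outside C₃ out-k) (trans (old _ j₃≤k k≤t₃) (sym (restrict-outside C₃ out-t₃)))
        case-⊇ C₃⊈C C⊆C₃ j₃≤k k≤t₃ (yes ins-k@(_ , k<tj)) (no out-t₃) =
          ⊥-elim (C₃⊈C (meets-across-tj (ℕP.≤-<-trans j₃≤k k<tj) (after-tj ins-k out-t₃ k≤t₃)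
                                        cs∈C (C⊆C₃ cs∈C)))
        case-⊇ C₃⊈C C⊆C₃ {k} j₃≤k k≤t₃ (no out-k) (yes ins-t₃@(ti<t₃ , _)) = begin
          restrict (π' k) C₃            ≡⟨ restrict-outside C₃ out-k ⟩
          restrict (π k) C₃             ≡⟨ old k j₃≤k k≤t₃ ⟩
          restrict (π t₃) C₃            ≡⟨ old-ti ⟨
          restrict (π ti) C₃            ≡⟨ gather-restrict-ti C⊆C₃ ⟨
          gather (restrict (π ti) C₃)   ≡⟨ cong gather old-ti ⟩
          gather (restrict (π t₃) C₃)   ≡⟨ restrict-⊇ C⊆C₃ ins-t₃ ⟨
          restrict (π' t₃) C₃           ∎
          where
          open ≡-Reasoning
          old-ti : restrict (π ti) C₃ ≡ restrict (π t₃) C₃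
          old-ti = old ti (ℕP.≤-trans j₃≤k (before-ti out-k ins-t₃ k≤t₃)) (<⇒≤ ti<t₃)

        -- No step of j₃ … t₃ lies in the window: quietness of I₃'s span at tj, or of the window
        -- at t₃, would force one of the two inclusions.
        case-crossing : ∀ {z} → z ∈ₛ C → z ∈ₛ C₃ → ¬ (C₃ ⊆ₛ C) → ¬ (C ⊆ₛ C₃) →
                        ∀ {k} → j₃ F.≤ k → k F.≤ t₃ → Goal k
        case-crossing z∈C z∈C₃ C₃⊈C C⊈C₃ j₃≤k k≤t₃ =
          trans (restrict-outside C₃ (never-inside j₃≤k k≤t₃))
                (trans (old _ j₃≤k k≤t₃)
                       (sym (restrict-outside C₃ (never-inside (ℕP.≤-trans j₃≤k k≤t₃) ℕP.≤-refl))))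
          where
          never-inside : ∀ {m} → j₃ F.≤ m → m F.≤ t₃ → ¬ Inside m
          never-inside j₃≤m m≤t₃ (ti<m , m<tj) with t₃ F.<? tj
          ... | no  t₃≮tj = C₃⊈C (meets-across-tj (ℕP.≤-<-trans j₃≤m m<tj) (ℕP.≮⇒≥ t₃≮tj) z∈C z∈C₃)
          ... | yes t₃<tj =
            C⊈C₃ (quiet-meets⇒⊆ {I = I₃} (quiet t₃ (ℕP.<-≤-trans ti<m m≤t₃) t₃<tj) refl z∈C z∈C₃)

        case-disjoint : (∀ {x} → x ∈ₛ C₃ → x ∉ₛ C) → ∀ {k} → j₃ F.≤ k → k F.≤ t₃ → Goal k
        case-disjoint C₃∩C=∅ {k} j₃≤k k≤t₃ =
          trans (restrict-disjoint k C₃∩C=∅) (trans (old k j₃≤k k≤t₃) (sym (restrict-disjoint t₃ C₃∩C=∅)))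

      repaired-type1 : Type1Consistent S → Type1Consistent repaired
      repaired-type1 t1 I₃ j₃ start k j₃≤k k≤t₃
        with char I₃ ⊆ₛ? C | C ⊆ₛ? char I₃ | FP.any? (λ z → (z ∈ₛ? C) ×-dec (z ∈ₛ? char I₃))
      ... | yes C₃⊆C | _        | _                    =
        case-⊆ C₃⊆C j₃≤k k≤t₃ (inside? k) (inside? (time I₃))
        where open Type1 t1 start
      ... | no C₃⊈C  | yes C⊆C₃ | _                    =
        case-⊇ C₃⊈C C⊆C₃ j₃≤k k≤t₃ (inside? k) (inside? (time I₃))
        where open Type1 t1 start
      ... | no C₃⊈C  | no C⊈C₃  | yes (z , z∈C , z∈C₃) =
        case-crossing z∈C z∈C₃ C₃⊈C C⊈C₃ j₃≤k k≤t₃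
        where open Type1 t1 start
      ... | no _     | no _     | no C∩C₃=∅            =
        case-disjoint (λ x∈C₃ x∈C → C∩C₃=∅ (_ , x∈C , x∈C₃)) j₃≤k k≤t₃
        where open Type1 t1 start

      block-order-CN : ∀ {l x y} → Unique l → Consecutive Ins l C → x ∈ₛ C → y ∉ₛ C →
                       (x ≺⟨ l ⟩ y) ≡ (cs ≺⟨ l ⟩ y)
      block-order-CN ul (u , v , w , refl , v≈C) x∈C y∉C =
        block-≺-representative u v w ul (proj₂ (v≈C _) x∈C) (proj₂ (v≈C _) cs∈C) (y∉C ∘ proj₁ (v≈C _))

      block-order-NC : ∀ {l x y} → Unique l → Consecutive Ins l C → x ∉ₛ C → y ∈ₛ C →
                       (x ≺⟨ l ⟩ y) ≡ (x ≺⟨ l ⟩ cs)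
      block-order-NC ul (u , v , w , refl , v≈C) x∉C y∈C =
        ≺-block-representative u v w ul (x∉C ∘ proj₁ (v≈C _)) (proj₂ (v≈C _) y∈C) (proj₂ (v≈C _) cs∈C)

      order-CN : ∀ {t x y} → ti F.≤ t → t F.≤ tj → x ∈ₛ C → y ∉ₛ C →
                 (x ≺⟨ π' t ⟩ y) ≡ (cs ≺⟨ π t ⟩ y)
      order-CN {t} ti≤t t≤tj x∈C y∉C with inside? t
      ... | yes ins = gather-≺ (C⊆ω x∈C) y∉C (perm-unique S t) (cs∈π ins)
      ... | no  out = block-order-CN (perm-unique S t) (endpoint-block ti≤t t≤tj out) x∈C y∉C

      order-NC : ∀ {t x y} → ti F.≤ t → t F.≤ tj → x ∉ₛ C → y ∈ₛ C →
                 (x ≺⟨ π' t ⟩ y) ≡ (x ≺⟨ π t ⟩ cs)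
      order-NC {t} ti≤t t≤tj x∉C y∈C with inside? t
      ... | yes ins = ≺-gather x∉C (C⊆ω y∈C) (perm-unique S t) (cs∈π ins)
      ... | no  out = block-order-NC (perm-unique S t) (endpoint-block ti≤t t≤tj out) x∉C y∈C

      order-NN : ∀ t {x y} → x ∉ₛ C → y ∉ₛ C → (x ≺⟨ π' t ⟩ y) ≡ (x ≺⟨ π t ⟩ y)
      order-NN t x∉C y∉C with inside? t
      ... | yes ins = ≺-gather-outside x∉C y∉C (perm-unique S t) (cs∈π ins)
      ... | no  _   = refl

      order-CC : ∀ {t x y} → Inside t → x ∈ₛ C → y ∈ₛ C → (x ≺⟨ π' t ⟩ y) ≡ (x ≺⟨ π ti ⟩ y)
      order-CC {t} {x} {y} ins x∈C y∈C =
        trans (cong (λ l → x ≺⟨ l ⟩ y) (π'-inside ins))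
              (trans (≺-gather-inside x∈C y∈C (perm-unique S t) (cs∈π ins)) (≺-filter (_∈ₛ? C) x∈C y∈C (π ti)))

      crossingAt-CN : ∀ {s x y} → T (inWindow (toℕ ti) (toℕ tj) s) → x ∈ₛ C → y ∉ₛ C →
                      crossingAt π' s x y ≡ crossingAt π s cs y
      crossingAt-CN {s} {x} {y} w x∈C y∉C =
        trans (⟦⟧·-yes (both-active? (clamp s) (clamp (suc s)) x) (C-active-step x∈C) _)
        (trans (⟦⟧·-cong (does (both-active? (clamp s) (clamp (suc s)) y)) λ _ →
                  cong₂ (λ a b → ⟦ a ∧ b ⟧) (order-CN ti≤now now≤tj x∈C y∉C)
                                             (order-NC ti≤next next≤tj y∉C x∈C))
               (sym (⟦⟧·-yes (both-active? (clamp s) (clamp (suc s)) cs) (C-active-step cs∈C) _)))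
        where open Step w

      crossingAt-NC : ∀ {s x y} → T (inWindow (toℕ ti) (toℕ tj) s) → x ∉ₛ C → y ∈ₛ C →
                      crossingAt π' s x y ≡ crossingAt π s x cs
      crossingAt-NC {s} {x} {y} w x∉C y∈C = ⟦⟧·-cong (does (both-active? (clamp s) (clamp (suc s)) x)) λ _ →
        trans (⟦⟧·-yes (both-active? (clamp s) (clamp (suc s)) y) (C-active-step y∈C) _)
        (trans (cong₂ (λ a b → ⟦ a ∧ b ⟧) (order-NC ti≤now now≤tj x∉C y∈C)
                                          (order-CN ti≤next next≤tj y∈C x∉C))
               (sym (⟦⟧·-yes (both-active? (clamp s) (clamp (suc s)) cs) (C-active-step cs∈C) _)))
        where open Step w

      crossingAt-NN : ∀ s {x y} → x ∉ₛ C → y ∉ₛ C → crossingAt π' s x y ≡ crossingAt π s x y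
      crossingAt-NN s {x} {y} x∉C y∉C =
        cong₂ (λ a b → ⟦ does (both-active? (clamp s) (clamp (suc s)) x) ⟧·
                       ⟦ does (both-active? (clamp s) (clamp (suc s)) y) ⟧· ⟦ a ∧ b ⟧)
              (order-NN (clamp s) x∉C y∉C) (order-NN (clamp (suc s)) y∉C x∉C)

      crossingAt-outside : ∀ {s} → s < ℕ.pred L → T (not (inWindow (toℕ ti) (toℕ tj) s)) →
                           ∀ x y → crossingAt π' s x y ≡ crossingAt π s x y
      crossingAt-outside {s} s<k w x y =
        cong₂ (λ l l' → ⟦ does (both-active? (clamp s) (clamp (suc s)) x) ⟧·
                        ⟦ does (both-active? (clamp s) (clamp (suc s)) y) ⟧·
                        ⟦ (x ≺⟨ l ⟩ y) ∧ (y ≺⟨ l' ⟩ x) ⟧)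
              (π'-outside (not-inside (ℕP.≤-reflexive (sym now))
                                      (ℕP.≤-trans (ℕP.≤-reflexive now) (ℕP.n≤1+n s))))
              (π'-outside (not-inside (ℕP.≤-trans (ℕP.n≤1+n s) (ℕP.≤-reflexive (sym next)))
                                      (ℕP.≤-reflexive next)))
        where
        s+1<L : suc s < L
        s+1<L = ℕP.<-≤-trans (s<s s<k) (ℕP.≤-reflexive (ℕP.suc-pred L))
        now : toℕ (clamp {L} s) ≡ s
        now = toℕ-clamp {L} (ℕP.<-trans (ℕP.n<1+n s) s+1<L)
        next : toℕ (clamp {L} (suc s)) ≡ suc s
        next = toℕ-clamp {L} s+1<L
        not-inside : ∀ {t} → s ≤ toℕ t → toℕ t ≤ suc s → ¬ Inside t
        not-inside s≤t t≤s+1 (ti<t , t<tj) with inWindow-outside {toℕ ti} {toℕ tj} w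
        ... | inj₁ s<i = ℕP.<-irrefl refl (ℕP.<-≤-trans s<i (ℕ.s≤s⁻¹ (ℕP.<-≤-trans ti<t t≤s+1)))
        ... | inj₂ j≤s = ℕP.<-irrefl refl (ℕP.<-≤-trans t<tj (ℕP.≤-trans j≤s s≤t))

      windowCrossings-CN : ∀ {x y} → x ∈ₛ C → y ∉ₛ C → windowCrossings π' x y ≡ windowCrossings π cs y
      windowCrossings-CN x∈C y∉C = ∑⟨⟩-cong inWindowStep (λ s w → crossingAt-CN w x∈C y∉C)

      windowCrossings-NC : ∀ {x y} → x ∉ₛ C → y ∈ₛ C → windowCrossings π' x y ≡ windowCrossings π x cs
      windowCrossings-NC x∉C y∈C = ∑⟨⟩-cong inWindowStep (λ s w → crossingAt-NC w x∉C y∈C)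

      windowCrossings-NN : ∀ {x y} → x ∉ₛ C → y ∉ₛ C → windowCrossings π' x y ≡ windowCrossings π x y
      windowCrossings-NN x∉C y∉C = ∑⟨⟩-cong inWindowStep (λ s _ → crossingAt-NN (toℕ s) x∉C y∉C)

      outsideCrossings-unchanged : ∀ x y → outsideCrossings π' x y ≡ outsideCrossings π x y
      outsideCrossings-unchanged x y = ∑⟨⟩-cong (not ∘ inWindowStep) (λ s w → crossingAt-outside (FP.toℕ<n s) w x y)

      -- Inside the window π' keeps the members of C in their order at ti, so each such pair
      -- crosses there at most once, and only if it also crosses under π.
      windowCrossings-CC : ∀ {x y} → x ∈ₛ C → y ∈ₛ C → windowCrossings π' x y ≤ windowCrossings π x y
      windowCrossings-CC {x} {y} x∈C y∈C = begin
        windowCrossings π' x y   ≡⟨ windowCrossings-descents repaired x∈C y∈C ⟩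
        windowDescents i j k G'  ≤⟨ windowDescents-constant k i j G' ti<tj G'-constant ⟩
        ⟦ G' i ∧ not (G' j) ⟧    ≡⟨ cong₂ (λ a b → ⟦ a ∧ not b ⟧)
                                          (unchanged-at ti-outside) (unchanged-at tj-outside) ⟩
        ⟦ G i ∧ not (G j) ⟧      ≤⟨ windowDescents-≥ k i j G (<⇒≤ ti<tj) (ℕP.pred-mono-≤ (FP.toℕ<n tj)) ⟩
        windowDescents i j k G   ≡⟨ windowCrossings-descents S x∈C y∈C ⟨
        windowCrossings π x y    ∎
        where
        open ℕP.≤-Reasoning
        i j k : ℕ
        i = toℕ ti
        j = toℕ tj
        k = ℕ.pred L
        G G' : ℕ → Bool
        G  m = x ≺⟨ π  (clamp m) ⟩ y
        G' m = x ≺⟨ π' (clamp m) ⟩ y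
        unchanged-at : ∀ {t} → ¬ Inside t → G' (toℕ t) ≡ G (toℕ t)
        unchanged-at {t} out rewrite clamp-toℕ t = cong (λ l → x ≺⟨ l ⟩ y) (π'-outside out)
        G'-constant : ∀ m → i ≤ m → m < j → G' m ≡ G' i
        G'-constant m i≤m m<j with i ℕP.≟ m
        ... | yes refl = refl
        ... | no  i≢m  = trans (order-CC inside x∈C y∈C)
                               (trans (cong (λ t → x ≺⟨ π t ⟩ y) (sym (clamp-toℕ ti))) (sym (unchanged-at ti-outside)))
          where
          m≡ : toℕ (clamp {L} m) ≡ m
          m≡ = toℕ-clamp {L} (ℕP.<-trans m<j (FP.toℕ<n tj))
          inside : Inside (clamp m)
          inside = ℕP.<-≤-trans (ℕP.≤∧≢⇒< i≤m i≢m) (ℕP.≤-reflexive (sym m≡)) ,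
                   ℕP.≤-<-trans (ℕP.≤-reflexive m≡) m<j

      repaired-cr : (∀ {x} → x ∈ₛ C → pivotCost cs ≤ pivotCost x) → cr repaired ≤ cr S
      repaired-cr cs-min = begin
        cr repaired                                          ≡⟨ cr-split repaired ⟩
        ∑∑ (windowCrossings π') + ∑∑ (outsideCrossings π')   ≤⟨ +-mono-≤ window-≤ (ℕP.≤-reflexive outside-≡) ⟩
        ∑∑ (windowCrossings π) + ∑∑ (outsideCrossings π)     ≡⟨ cr-split S ⟨
        cr S                                                 ∎
        where
        open ℕP.≤-Reasoning
        outside-≡ : ∑∑ (outsideCrossings π') ≡ ∑∑ (outsideCrossings π)
        outside-≡ = sum-cong-≗ {N} (λ x → sum-cong-≗ {N} (outsideCrossings-unchanged x))
        window-≤ : ∑∑ (windowCrossings π') ≤ ∑∑ (windowCrossings π)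
        window-≤ = ∑∑-≤-representative inC (windowCrossings π') (windowCrossings π) cs
          (λ x y x∈ y∈ → windowCrossings-CC (witness (x ∈ₛ? C) x∈) (witness (y ∈ₛ? C) y∈))
          (λ x y x∈ y∉ → windowCrossings-CN (witness (x ∈ₛ? C) x∈) (witness¬ (y ∈ₛ? C) y∉))
          (λ x y x∉ y∈ → windowCrossings-NC (witness¬ (x ∈ₛ? C) x∉) (witness (y ∈ₛ? C) y∈))
          (λ x y x∉ y∉ → windowCrossings-NN (witness¬ (x ∈ₛ? C) x∉) (witness¬ (y ∈ₛ? C) y∉))
          (λ x x∈ → cs-min (witness (x ∈ₛ? C) x∈))

    Pivot : Set
    Pivot = (∀ {x} → x ∉ₛ C) ⊎ ∃ λ cs → cs ∈ₛ C × (∀ {x} → x ∈ₛ C → pivotCost cs ≤ pivotCost x)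

    cheapest-pivot : Pivot
    cheapest-pivot with ω | ω⊆C | C⊆ω
    ... | []      | _              | C⊆[]  = inj₁ (λ x∈C → case C⊆[] x∈C of λ ())
    ... | c₀ ∷ ω' | c₀∈C ∷ ω'⊆C | C⊆c₀ω' =
      inj₂ (argmin pivotCost c₀ ω' , argmin-all pivotCost c₀∈C ω'⊆C , cheapest ∘ C⊆c₀ω')
      where
      cheapest : ∀ {x} → x ∈ c₀ ∷ ω' → pivotCost (argmin pivotCost c₀ ω') ≤ pivotCost x
      cheapest (here refl) = f[argmin]≤f[⊤] {f = pivotCost} c₀ ω'
      cheapest (there x∈ω') = All.lookup (f[argmin]≤f[xs] {f = pivotCost} c₀ ω') x∈ω'

    repairWith : Pivot → Solution Ins
    repairWith (inj₁ _)              = S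
    repairWith (inj₂ (cs , cs∈C , _)) = Repair.repaired cs cs∈C

    repairWith-consistent : ∀ p → Pair-consistent (repairWith p) I₁ I₂
    repairWith-consistent (inj₁ C=∅) k _ _ =
      [] , π k , cong (_++ π k) (sym (filter-none (_∈ₛ? C) {π ti} (All.tabulate (λ _ → C=∅))))
    repairWith-consistent (inj₂ (cs , cs∈C , _)) = Repair.repaired-consistent cs cs∈C

    repairWith-keeps : ∀ p {Q₁ Q₂} → Type2Pair {Ins} Q₁ Q₂ → time Q₁ F.≤ ti →
                       Pair-consistent S Q₁ Q₂ → Pair-consistent (repairWith p) Q₁ Q₂
    repairWith-keeps (inj₁ _)               _     _     pc = pc
    repairWith-keeps (inj₂ (cs , cs∈C , _)) pairQ tq≤ti pc = Repair.repaired-keeps cs cs∈C pairQ tq≤ti pc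

    repairWith-cr : ∀ p → cr (repairWith p) ≤ cr S
    repairWith-cr (inj₁ _)                   = ℕP.≤-refl
    repairWith-cr (inj₂ (cs , cs∈C , cs-min)) = Repair.repaired-cr cs cs∈C cs-min

    repairWith-type1 : ∀ p → Type1Consistent S → Type1Consistent (repairWith p)
    repairWith-type1 (inj₁ _)               t1 = t1
    repairWith-type1 (inj₂ (cs , cs∈C , _)) t1 = Repair.repaired-type1 cs cs∈C t1

  quiet? : ∀ k D → Dec (Quiet {Ins} k D)
  quiet? k D =
    FP.all? (λ I → (time I F.≟ k) →-dec FP.all? (λ c → (c ∈ₛ? char I) →-dec ((c ∈ₛ? D) →-dec no (λ ()))))
    ⊎-dec FP.any? (λ I → (time I F.≟ k) ×-dec (D ⊆ₛ? char I))

  type2Pair? : ∀ I₁ I₂ → Dec (Type2Pair {Ins} I₁ I₂)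
  type2Pair? I₁ I₂ =
    ≡-dec Bool._≟_ (char I₁) (char I₂) ×-dec (time I₁ F.<? time I₂)
    ×-dec FP.all? (λ k → (time I₁ F.<? k) →-dec ((k F.<? time I₂) →-dec quiet? k (char I₁)))

  PairFixed : Fin M × Fin M → Solution Ins → Set
  PairFixed (I₁ , I₂) S = Type2Pair {Ins} I₁ I₂ → Pair-consistent S I₁ I₂

  pairRank : Fin M × Fin M → ℕ
  pairRank (I₁ , _) = toℕ (time I₁)

  fixPair : Fin M × Fin M → Solution Ins → Solution Ins
  fixPair (I₁ , I₂) S with type2Pair? I₁ I₂
  ... | yes pair = Window.repairWith S pair (Window.cheapest-pivot S pair)
  ... | no  _    = S

  fixPair-fixes : ∀ a S → PairFixed a (fixPair a S)
  fixPair-fixes (I₁ , I₂) S with type2Pair? I₁ I₂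
  ... | yes pair = λ _ → repairWith-consistent cheapest-pivot
    where open Window S pair
  ... | no ¬pair = λ pair → ⊥-elim (¬pair pair)

  fixPair-keeps : ∀ a b S → pairRank b ≤ pairRank a → PairFixed b S → PairFixed b (fixPair a S)
  fixPair-keeps (I₁ , I₂) b S b≤a fixed with type2Pair? I₁ I₂
  ... | yes pair = λ pairQ → repairWith-keeps cheapest-pivot pairQ b≤a (fixed pairQ)
    where open Window S pair
  ... | no  _    = fixed

  _⊑_ : Solution Ins → Solution Ins → Set
  S' ⊑ S = cr S' ≤ cr S × (Type1Consistent S → Type1Consistent S')

  fixPair-⊑ : ∀ a S → fixPair a S ⊑ S
  fixPair-⊑ (I₁ , I₂) S with type2Pair? I₁ I₂
  ... | yes pair = repairWith-cr cheapest-pivot , repairWith-type1 cheapest-pivot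
    where open Window S pair
  ... | no  _    = ℕP.≤-refl , λ t1 → t1

  open Sweep pairRank fixPair PairFixed fixPair-fixes fixPair-keeps (cartesianProduct (allFin M) (allFin M)) public

  swept-type2 : ∀ S → Type2Consistent (sweep L S)
  swept-type2 S I₁ I₂ = sweep-fixes L S (∈-cartesianProduct⁺ (∈-allFin I₁) (∈-allFin I₂)) (FP.toℕ<n (time I₁))

  swept-⊑ : ∀ S → sweep L S ⊑ S
  swept-⊑ = sweep-⊑ _⊑_ (ℕP.≤-refl , λ t1 → t1) (λ (cr₁ , t₁) (cr₂ , t₂) → ℕP.≤-trans cr₁ cr₂ , t₁ ∘ t₂)
                    fixPair-⊑ L

lemma8 : (Ins : Instance) (S : Solution Ins) →
    Σ (Solution Ins) (λ S' →
    Type2Consistent S' × cr S' ≤ cr S × (Type1Consistent S → Type1Consistent S'))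
lemma8 Ins S = sweep (Instance.ℓ Ins) S , swept-type2 S , swept-⊑ S
  where open Storyline Ins
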